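{- Let $a,b,n$ be positive integers with $n\geq a+b$, and suppose there is a linked $(a,b)$ knight's tour in $[n]^2$. Then for every integer $d\geq 2$, the $(a,b)$ knight's graph on $[n]^d$ has a Hamiltonian cycle.
   Context: $[n]=\{0,\dots,n-1\}$. The $(a,b)$ knight's graph on $[n]^d$ has vertex set $[n]^d$, two vertices adjacent iff they differ in exactly two coordinates, by $a$ in absolute value in one and by $b$ in absolute value in the other; an $(a,b)$ knight's tour is a Hamiltonian cycle of it. A 2-dimensional $(a,b)$ knight's tour in $[n]^2$ is linked if it contains both the edge $\{(0,b),(a,0)\}$ (link $\alpha$) and the edge $\{(n-1,a),(n-b-1,0)\}$ (link $\beta$). -}

module Defs where

open import Level using (Level)
open import Data.Nat using (ℕ; zero; suc; _≤_; ∣_-_∣)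
open import Data.Fin using (Fin; toℕ; inject₁; fromℕ)
open import Data.Vec using (Vec; lookup; _∷_; [])
open import Data.Product using (Σ; ∃; ∃-syntax; _×_; _,_)
open import Data.Sum using (_⊎_)
open import Function.Definitions using (Injective; Surjective)
open import Relation.Binary.PropositionalEquality using (_≡_; _≢_)

Point : ℕ → ℕ → Set
Point n d = Vec (Fin n) d

KnightAdj : (a b n d : ℕ) → Point n d → Point n d → Set
KnightAdj a b n d x y =
  Σ (Fin d) λ i → Σ (Fin d) λ j →
    i ≢ j
    × ∣ toℕ (lookup x i) - toℕ (lookup y i) ∣ ≡ a
    × ∣ toℕ (lookup x j) - toℕ (lookup y j) ∣ ≡ b
    × (∀ k → k ≢ i → k ≢ j → lookup x k ≡ lookup y k)

data CycSucc : {m : ℕ} → Fin (suc m) → Fin (suc m) → Set where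
  step : {m : ℕ} (i : Fin m) → CycSucc (inject₁ i) (Fin.suc i)
  wrap : {m : ℕ} → CycSucc (fromℕ m) (Fin.zero {m})

record HamiltonianCycle {V : Set} (E : V → V → Set) : Set where
  field
    len-1    : ℕ
    len≥3    : 2 ≤ len-1
    cyc      : Fin (suc len-1) → V
    injCyc   : Injective _≡_ _≡_ cyc
    surjCyc  : Surjective _≡_ _≡_ cyc
    adjCyc   : ∀ i j → CycSucc i j → E (cyc i) (cyc j)

coords : {n : ℕ} → Point n 2 → ℕ × ℕ
coords (x ∷ y ∷ []) = toℕ x , toℕ y

ContainsEdge : {n : ℕ} {E : Point n 2 → Point n 2 → Set} →
               HamiltonianCycle E → ℕ × ℕ → ℕ × ℕ → Set
ContainsEdge H p q =
  ∃[ i ] ∃[ j ] CycSucc i j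
    × ((coords (cyc i) ≡ p × coords (cyc j) ≡ q)
       ⊎ (coords (cyc i) ≡ q × coords (cyc j) ≡ p))
  where open HamiltonianCycle H

KnightTour : (a b n d : ℕ) → Set
KnightTour a b n d = HamiltonianCycle (KnightAdj a b n d)

Linked : {a b n : ℕ} → KnightTour a b n 2 → Set
Linked {a} {b} {n} T =
  ContainsEdge T (0 , b) (a , 0)
  × ContainsEdge T (n Data.Nat.∸ 1 , a) (n Data.Nat.∸ b Data.Nat.∸ 1 , 0)

-- Carry a Hamiltonian cycle of [n]^d with two pairs of edges (α, α′), (β, β′)
-- whose copies in two parallel layers at distance a or b can be exchanged for two knight moves
-- between the layers; for d = 2 these are the two links and the edges at the corners (0, 0)
-- and (n - 1, 0), which every tour must use. To go up one dimension, put a copy of the cycle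
-- in every layer and join the copies one at a time. Write {a, b} = {m, k} with m < k (a ≠ b,
-- and gcd(a, b) = 1 since the tour is connected). Layers 0, …, m + k - 2 are joined along the
-- walk w ↦ w + m (w < k), w ↦ w - k (w ≥ k), which visits each of them; every further layer
-- T < n - 1 is joined to T - m through α, and layer n - 1 to n - 1 - k through β. No copy of
-- an edge is used twice, and layer n - 1 keeps α, α′ and layer m - 1 or k - 1 keeps β, β′.

module Submission where

open import Defs
open import Data.Nat using (ℕ; zero; suc; _≤_; _+_; _∸_; s≤s)
open import Data.Nat.Properties using (m∸n+n≡m; +-suc)
open import Data.Nat.Coprimality using (Coprime)
open import Data.Product using (Σ; _,_)
open import Relation.Binary.PropositionalEquality using (subst)

module CyclicList where

  open import Data.List using (List; []; _∷_; _++_; map; reverse)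
  open import Data.List.Properties
    using (++-assoc; ∷-injective; ∷ʳ-injective; map-++; reverse-++; unfold-reverse; reverse-involutive)
  open import Data.List.Relation.Binary.Permutation.Propositional using (_↭_; ↭-refl)
  open import Data.List.Relation.Binary.Permutation.Propositional.Properties using (++-comm)
  open import Data.Product using (Σ; _×_; _,_; proj₁; proj₂)
  open import Data.Sum using (_⊎_; inj₁; inj₂)
  open import Data.Empty using (⊥-elim)
  open import Data.List.Membership.Propositional using (_∈_)
  open import Data.List.Relation.Unary.Any using (here; there)
  open import Relation.Nullary using (¬_)
  open import Relation.Binary.PropositionalEquality

  private variable
    V W : Set

  Consecutive : List V → V → V → Set
  Consecutive l x y = Σ (List _) λ A → Σ (List _) λ B → l ≡ A ++ x ∷ y ∷ B

  Closing : List V → V → V → Set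
  Closing l x y = Σ (List _) λ B → l ≡ y ∷ (B ++ x ∷ [])

  -- The list v₀ ∷ … ∷ vₖ ∷ [] stands for the cycle v₀ → … → vₖ → v₀, whose steps are the Succ pairs.
  Succ : List V → V → V → Set
  Succ l x y = Consecutive l x y ⊎ Closing l x y

  Edge : List V → V → V → Set
  Edge l x y = Succ l x y ⊎ Succ l y x

  SameEdge : V → V → V → V → Set
  SameEdge x y u v = (x ≡ u × y ≡ v) ⊎ (x ≡ v × y ≡ u)

  Edge-sym : ∀ {l : List V} {x y} → Edge l x y → Edge l y x
  Edge-sym (inj₁ s) = inj₂ s
  Edge-sym (inj₂ s) = inj₁ s

  SameEdge-sym : ∀ {x y u v : V} → SameEdge x y u v → SameEdge u v x y
  SameEdge-sym (inj₁ (refl , refl)) = inj₁ (refl , refl)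
  SameEdge-sym (inj₂ (refl , refl)) = inj₂ (refl , refl)

  SameEdge-trans : ∀ {x y u v p q : V} → SameEdge x y u v → SameEdge u v p q → SameEdge x y p q
  SameEdge-trans (inj₁ (refl , refl)) e = e
  SameEdge-trans (inj₂ (refl , refl)) (inj₁ (p , q)) = inj₂ (q , p)
  SameEdge-trans (inj₂ (refl , refl)) (inj₂ (p , q)) = inj₁ (q , p)

  Consecutive-++ˡ : ∀ (P Q : List V) {x y} → Consecutive P x y → Consecutive (P ++ Q) x y
  Consecutive-++ˡ P Q (A , B , refl) = A , B ++ Q , ++-assoc A _ Q

  Consecutive-++ʳ : ∀ (P Q : List V) {x y} → Consecutive Q x y → Consecutive (P ++ Q) x y
  Consecutive-++ʳ P Q (A , B , refl) = P ++ A , B , sym (++-assoc P A _)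

  Consecutive-junction : ∀ (P Q : List V) {x y} → Consecutive ((P ++ x ∷ []) ++ y ∷ Q) x y
  Consecutive-junction P Q {x} {y} = P , Q , ++-assoc P (x ∷ []) (y ∷ Q)

  EndsWith : List V → V → Set
  EndsWith P x = Σ (List _) λ P′ → P ≡ P′ ++ x ∷ []

  StartsWith : List V → V → Set
  StartsWith Q y = Σ (List _) λ Q′ → Q ≡ y ∷ Q′

  Consecutive-++⁻ : ∀ (P Q : List V) {x y} → Consecutive (P ++ Q) x y →
                    Consecutive P x y ⊎ Consecutive Q x y ⊎ (EndsWith P x × StartsWith Q y)
  Consecutive-++⁻ [] Q c = inj₂ (inj₁ c)
  Consecutive-++⁻ (p ∷ []) Q ([] , B , eq) with ∷-injective eq
  ... | refl , refl = inj₂ (inj₂ (([] , refl) , (B , refl)))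
  Consecutive-++⁻ (p ∷ p′ ∷ P) Q ([] , B , eq) with ∷-injective eq
  ... | refl , eq′ with ∷-injective eq′
  ... | refl , _ = inj₁ ([] , P , refl)
  Consecutive-++⁻ (p ∷ P) Q (_ ∷ A , B , eq) with ∷-injective eq
  ... | refl , eq′ with Consecutive-++⁻ P Q (A , B , eq′)
  ... | inj₁ (A′ , B′ , e) = inj₁ (p ∷ A′ , B′ , cong (p ∷_) e)
  ... | inj₂ (inj₁ c) = inj₂ (inj₁ c)
  ... | inj₂ (inj₂ ((P′ , e) , q)) = inj₂ (inj₂ ((p ∷ P′ , cong (p ∷_) e) , q))

  StartsWith-++⁻ˡ : ∀ (A : List V) {x Q q} → StartsWith ((A ++ x ∷ []) ++ Q) q → StartsWith (A ++ x ∷ []) q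
  StartsWith-++⁻ˡ [] (_ , eq) with ∷-injective eq
  ... | refl , _ = [] , refl
  StartsWith-++⁻ˡ (a ∷ A) {x} (_ , eq) with ∷-injective eq
  ... | refl , _ = A ++ x ∷ [] , refl

  EndsWith-++⁻ʳ : ∀ (P : List V) {y B p} → EndsWith (P ++ y ∷ B) p → EndsWith (y ∷ B) p
  EndsWith-++⁻ʳ [] e = e
  EndsWith-++⁻ʳ (_ ∷ []) ([] , ())
  EndsWith-++⁻ʳ (_ ∷ _ ∷ _) ([] , ())
  EndsWith-++⁻ʳ (_ ∷ P) (_ ∷ B′ , eq) = EndsWith-++⁻ʳ P (B′ , proj₂ (∷-injective eq))

  Consecutive-constant : ∀ {A : Set} (f : V → A) {h} (l : List V) →
                         (∀ {x y} → Consecutive (h ∷ l) x y → f x ≡ f y) → ∀ {v} → v ∈ h ∷ l → f v ≡ f h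
  Consecutive-constant f l _ (here refl) = refl
  Consecutive-constant f {h} (h′ ∷ l) const (there v∈) =
    trans (Consecutive-constant f l (λ (A , B , e) → const (h ∷ A , B , cong (h ∷_) e)) v∈)
          (sym (const ([] , l , refl)))

  module _ (f : V → W) where

    Succ-map⁺ : ∀ {l x y} → Succ l x y → Succ (map f l) (f x) (f y)
    Succ-map⁺ (inj₁ (A , B , refl)) = inj₁ (map f A , map f B , map-++ f A _)
    Succ-map⁺ (inj₂ (B , refl)) = inj₂ (map f B , cong (f _ ∷_) (map-++ f B _))

    Edge-map⁺ : ∀ {l x y} → Edge l x y → Edge (map f l) (f x) (f y)
    Edge-map⁺ (inj₁ s) = inj₁ (Succ-map⁺ s)
    Edge-map⁺ (inj₂ s) = inj₂ (Succ-map⁺ s)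

    private
      Consecutive-map⁻ : ∀ l {x y} → Consecutive (map f l) x y →
                         Σ V λ x′ → Σ V λ y′ → f x′ ≡ x × f y′ ≡ y × Consecutive l x′ y′
      Consecutive-map⁻ (v ∷ w ∷ l) ([] , B , eq) with ∷-injective eq
      ... | e₁ , eq′ = v , w , e₁ , proj₁ (∷-injective eq′) , [] , l , refl
      Consecutive-map⁻ (v ∷ l) (_ ∷ A , B , eq) with Consecutive-map⁻ l (A , B , proj₂ (∷-injective eq))
      ... | x′ , y′ , e₁ , e₂ , A′ , B′ , e = x′ , y′ , e₁ , e₂ , v ∷ A′ , B′ , cong (v ∷_) e
      Consecutive-map⁻ [] ([] , _ , ())
      Consecutive-map⁻ [] (_ ∷ _ , _ , ())
      Consecutive-map⁻ (_ ∷ []) ([] , _ , ())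

      EndsWith-map⁻ : ∀ l {x} → EndsWith (map f l) x → Σ V λ x′ → f x′ ≡ x × EndsWith l x′
      EndsWith-map⁻ (v ∷ []) ([] , eq) = v , proj₁ (∷-injective eq) , [] , refl
      EndsWith-map⁻ (v ∷ w ∷ l) (_ ∷ B , eq) with EndsWith-map⁻ (w ∷ l) (B , proj₂ (∷-injective eq))
      ... | x′ , e , B′ , e′ = x′ , e , v ∷ B′ , cong (v ∷_) e′
      EndsWith-map⁻ [] ([] , ())
      EndsWith-map⁻ [] (_ ∷ _ , ())
      EndsWith-map⁻ (_ ∷ w ∷ l) ([] , eq) with () ← proj₂ (∷-injective eq)
      EndsWith-map⁻ (_ ∷ []) (_ ∷ [] , ())
      EndsWith-map⁻ (_ ∷ []) (_ ∷ _ ∷ _ , ())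

    Succ-map⁻ : ∀ l {x y} → Succ (map f l) x y →
                Σ V λ x′ → Σ V λ y′ → f x′ ≡ x × f y′ ≡ y × Succ l x′ y′
    Succ-map⁻ l (inj₁ c) with Consecutive-map⁻ l c
    ... | x′ , y′ , e₁ , e₂ , c′ = x′ , y′ , e₁ , e₂ , inj₁ c′
    Succ-map⁻ (v ∷ l) (inj₂ (B , eq)) with ∷-injective eq
    ... | e₁ , eq′ with EndsWith-map⁻ l (B , eq′)
    ... | x′ , e , B′ , refl = x′ , v , e , e₁ , inj₂ (B′ , refl)

  Succ-reverse : ∀ {l : List V} {x y} → Succ l x y → Succ (reverse l) y x
  Succ-reverse (inj₁ (A , B , refl)) = inj₁ (reverse B , reverse A , reverse-consecutive A _ _ B)
    where
    open ≡-Reasoning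
    reverse-consecutive : ∀ A (x y : V) B → reverse (A ++ x ∷ y ∷ B) ≡ reverse B ++ y ∷ x ∷ reverse A
    reverse-consecutive A x y B = begin
        reverse (A ++ x ∷ y ∷ B)                 ≡⟨ reverse-++ A (x ∷ y ∷ B) ⟩
        reverse (x ∷ y ∷ B) ++ reverse A         ≡⟨ cong (_++ reverse A) (unfold-reverse x (y ∷ B)) ⟩
        (reverse (y ∷ B) ++ x ∷ []) ++ reverse A ≡⟨ cong (λ z → (z ++ x ∷ []) ++ reverse A) (unfold-reverse y B) ⟩
        ((reverse B ++ y ∷ []) ++ x ∷ []) ++ reverse A
          ≡⟨ ++-assoc (reverse B ++ y ∷ []) (x ∷ []) (reverse A) ⟩
        (reverse B ++ y ∷ []) ++ x ∷ reverse A   ≡⟨ ++-assoc (reverse B) (y ∷ []) (x ∷ reverse A) ⟩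
        reverse B ++ y ∷ x ∷ reverse A           ∎
  Succ-reverse (inj₂ (B , refl)) = inj₂ (reverse B , reverse-closing _ B _)
    where
    open ≡-Reasoning
    reverse-closing : ∀ (y : V) B x → reverse (y ∷ (B ++ x ∷ [])) ≡ x ∷ (reverse B ++ y ∷ [])
    reverse-closing y B x = begin
        reverse (y ∷ (B ++ x ∷ []))       ≡⟨ unfold-reverse y (B ++ x ∷ []) ⟩
        reverse (B ++ x ∷ []) ++ y ∷ []   ≡⟨ cong (_++ y ∷ []) (reverse-++ B (x ∷ [])) ⟩
        x ∷ reverse B ++ y ∷ []           ∎

  Succ-reverse⁻ : ∀ {l : List V} {x y} → Succ (reverse l) x y → Succ l y x
  Succ-reverse⁻ {l = l} s = subst (λ l′ → Succ l′ _ _) (reverse-involutive l) (Succ-reverse s)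

  Edge-reverse⁺ : ∀ {l : List V} {x y} → Edge l x y → Edge (reverse l) x y
  Edge-reverse⁺ (inj₁ s) = inj₂ (Succ-reverse s)
  Edge-reverse⁺ (inj₂ s) = inj₁ (Succ-reverse s)

  record Rotation (l : List V) (x y : V) : Set where
    field
      middle   : List V
    rotated : List V
    rotated = y ∷ (middle ++ x ∷ [])
    field
      ↭-rotated : rotated ↭ l
      sound     : ∀ {p q} → Consecutive rotated p q → Succ l p q
      complete  : ∀ {p q} → Succ l p q → ¬ (p ≡ x × q ≡ y) → Consecutive rotated p q

  rotation : ∀ {l : List V} {x y} → Succ l x y → Rotation l x y
  rotation {x = x} {y} (inj₂ (B , refl)) = record
    { middle = B ; ↭-rotated = ↭-refl ; sound = inj₁ ; complete = complete }
    where
    complete : ∀ {p q} → Succ (y ∷ (B ++ x ∷ [])) p q → ¬ (p ≡ x × q ≡ y) → Consecutive (y ∷ (B ++ x ∷ [])) p q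
    complete (inj₁ c) _ = c
    complete (inj₂ (B′ , e)) p→q≢x→y with ∷-injective e
    ... | refl , e′ = ⊥-elim (p→q≢x→y (sym (proj₂ (∷ʳ-injective B B′ e′)) , refl))
  rotation {V = V} {x = x} {y} (inj₁ (A , B , refl)) = record
    { middle = B ++ A ; ↭-rotated = ↭-rotated ; sound = sound ; complete = complete }
    where
    R : List V
    R = y ∷ ((B ++ A) ++ x ∷ [])
    R≡ : R ≡ (y ∷ B) ++ (A ++ x ∷ [])
    R≡ = cong (y ∷_) (++-assoc B A (x ∷ []))
    l≡ : A ++ x ∷ y ∷ B ≡ (A ++ x ∷ []) ++ (y ∷ B)
    l≡ = sym (++-assoc A (x ∷ []) (y ∷ B))
    ↭-rotated : R ↭ A ++ x ∷ y ∷ B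
    ↭-rotated = subst₂ _↭_ (sym R≡) (sym l≡) (++-comm (y ∷ B) (A ++ x ∷ []))
    sound : ∀ {p q} → Consecutive R p q → Succ (A ++ x ∷ y ∷ B) p q
    sound {p} {q} c with Consecutive-++⁻ (y ∷ B) (A ++ x ∷ []) (subst (λ z → Consecutive z p q) R≡ c)
    ... | inj₁ c₁ = inj₁ (subst (λ z → Consecutive z p q) (sym l≡) (Consecutive-++ʳ (A ++ x ∷ []) (y ∷ B) c₁))
    ... | inj₂ (inj₁ c₂) = inj₁ (subst (λ z → Consecutive z p q) (sym l≡) (Consecutive-++ˡ (A ++ x ∷ []) (y ∷ B) c₂))
    ... | inj₂ (inj₂ ((P′ , e₁) , (Q′ , e₂))) = inj₂ (Q′ ++ P′ , (begin
          A ++ x ∷ y ∷ B                ≡⟨ l≡ ⟩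
          (A ++ x ∷ []) ++ (y ∷ B)      ≡⟨ cong₂ _++_ e₂ e₁ ⟩
          q ∷ (Q′ ++ (P′ ++ p ∷ []))    ≡⟨ cong (q ∷_) (sym (++-assoc Q′ P′ _)) ⟩
          q ∷ ((Q′ ++ P′) ++ p ∷ [])    ∎))
      where open ≡-Reasoning
    complete : ∀ {p q} → Succ (A ++ x ∷ y ∷ B) p q → ¬ (p ≡ x × q ≡ y) → Consecutive R p q
    complete {p} {q} (inj₁ c) p→q≢x→y
      with Consecutive-++⁻ (A ++ x ∷ []) (y ∷ B) (subst (λ z → Consecutive z p q) l≡ c)
    ... | inj₁ c₁ = subst (λ z → Consecutive z p q) (sym R≡) (Consecutive-++ʳ (y ∷ B) _ c₁)
    ... | inj₂ (inj₁ c₂) = subst (λ z → Consecutive z p q) (sym R≡) (Consecutive-++ˡ (y ∷ B) _ c₂)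
    ... | inj₂ (inj₂ ((P′ , e₁) , (Q′ , e₂))) =
          ⊥-elim (p→q≢x→y (sym (proj₂ (∷ʳ-injective A P′ e₁)) , sym (proj₁ (∷-injective e₂))))
    complete {p} {q} (inj₂ (B′ , e)) _ with StartsWith-++⁻ˡ A (B′ ++ p ∷ [] , trans (sym l≡) e)
                                           | EndsWith-++⁻ʳ (A ++ x ∷ []) (q ∷ B′ , trans (sym l≡) e)
    ... | P′ , e₁ | Q′ , e₂ = subst (λ z → Consecutive z p q) (sym R≡)
                               (subst₂ (λ u w → Consecutive (u ++ w) p q) (sym e₂) (sym e₁) (Consecutive-junction Q′ P′))

module Cycle {V : Set} (E : V → V → Set) (E-sym : ∀ {x y} → E x y → E y x) where

  open import Data.Nat using (_≤_; s≤s; z≤n)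
  open import Data.Nat.Properties using (≤-trans; n≤1+n)
  open import Data.List using (List; []; _∷_; _++_; length; reverse)
  open import Data.List.Properties using (++-assoc; ∷-injective; ∷ʳ-injective; length-reverse)
  open import Data.List.Membership.Propositional using (_∈_)
  open import Data.List.Membership.Propositional.Properties using (∈-++⁺ˡ; ∈-++⁺ʳ; ∈-++⁻)
  open import Data.List.Relation.Unary.Unique.Propositional using (Unique)
  import Data.List.Relation.Unary.Unique.Propositional.Properties as Unique
  open import Data.List.Relation.Binary.Permutation.Propositional using (_↭_; ↭-sym; ↭⇒↭ₛ)
  open import Data.List.Relation.Binary.Permutation.Propositional.Properties using (∈-resp-↭; ↭-reverse)
  import Data.List.Relation.Binary.Permutation.Setoid.Properties as Setoid
  open import Data.Product using (_×_; _,_)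
  open import Data.Sum using (_⊎_; inj₁; inj₂; map₂)
  open import Data.Empty using (⊥)
  open import Function using (_⇔_; mk⇔; Equivalence)
  open import Relation.Nullary using (¬_)
  open import Relation.Binary.PropositionalEquality
  open CyclicList

  record IsCycle (l : List V) : Set where
    field
      unique : Unique l
      length≥3 : 3 ≤ length l
      adjacent : ∀ {x y} → Succ l x y → E x y

  Unique-resp-↭ : ∀ {l l′ : List V} → l ↭ l′ → Unique l → Unique l′
  Unique-resp-↭ p = Setoid.Unique-resp-↭ (setoid V) (↭⇒↭ₛ p)

  IsCycle-reverse : ∀ {l} → IsCycle l → IsCycle (reverse l)
  IsCycle-reverse {l} c = record
    { unique = Unique-resp-↭ (↭-sym (↭-reverse l)) (IsCycle.unique c)
    ; length≥3 = subst (3 ≤_) (sym (length-reverse l)) (IsCycle.length≥3 c)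
    ; adjacent = λ s → E-sym (IsCycle.adjacent c (Succ-reverse⁻ s)) }

  Disjoint : List V → List V → Set
  Disjoint l₁ l₂ = ∀ {w} → w ∈ l₁ → w ∈ l₂ → ⊥

  SuccsKept : List V → V → V → List V → Set
  SuccsKept l x y L = ∀ {p q} → Succ l p q → ¬ (p ≡ x × q ≡ y) → Succ L p q

  EdgesKept : List V → V → V → List V → Set
  EdgesKept l u v L = ∀ {p q} → Edge l p q → ¬ SameEdge p q u v → Edge L p q

  record Joined (l₁ l₂ : List V) (Kept₁ Kept₂ : List V → Set) : Set where
    field
      joined   : List V
      isCycle  : IsCycle joined
      ∈-joined : ∀ {w} → w ∈ joined ⇔ (w ∈ l₁ ⊎ w ∈ l₂)
      keptˡ    : Kept₁ joined
      keptʳ    : Kept₂ joined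

  -- The joined cycle is y₁ … x₁ y₂ … x₂: the two cycles, rotated to open them at the deleted
  -- steps, laid end to end.
  joinSuccs : ∀ {l₁ l₂ x₁ y₁ x₂ y₂} → IsCycle l₁ → IsCycle l₂ → Disjoint l₁ l₂ →
              Succ l₁ x₁ y₁ → Succ l₂ x₂ y₂ → E x₁ y₂ → E x₂ y₁ →
              Joined l₁ l₂ (SuccsKept l₁ x₁ y₁) (SuccsKept l₂ x₂ y₂)
  joinSuccs {l₁} {l₂} {x₁} {y₁} {x₂} {y₂} c₁ c₂ disjoint s₁ s₂ x₁y₂ x₂y₁ = record
    { joined = R₁ ++ R₂ ; isCycle = isCycle ; ∈-joined = mk⇔ ∈-split ∈-join
    ; keptˡ = λ s ne → inj₁ (Consecutive-++ˡ R₁ R₂ (Rotation.complete r₁ s ne))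
    ; keptʳ = λ s ne → inj₁ (Consecutive-++ʳ R₁ R₂ (Rotation.complete r₂ s ne)) }
    where
    r₁ : Rotation l₁ x₁ y₁
    r₁ = rotation s₁
    r₂ : Rotation l₂ x₂ y₂
    r₂ = rotation s₂
    M₁ M₂ R₁ R₂ : List V
    M₁ = Rotation.middle r₁
    M₂ = Rotation.middle r₂
    R₁ = Rotation.rotated r₁
    R₂ = Rotation.rotated r₂
    ∈-split : ∀ {w} → w ∈ R₁ ++ R₂ → w ∈ l₁ ⊎ w ∈ l₂
    ∈-split i with ∈-++⁻ R₁ i
    ... | inj₁ j = inj₁ (∈-resp-↭ (Rotation.↭-rotated r₁) j)
    ... | inj₂ j = inj₂ (∈-resp-↭ (Rotation.↭-rotated r₂) j)
    ∈-join : ∀ {w} → w ∈ l₁ ⊎ w ∈ l₂ → w ∈ R₁ ++ R₂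
    ∈-join (inj₁ i) = ∈-++⁺ˡ (∈-resp-↭ (↭-sym (Rotation.↭-rotated r₁)) i)
    ∈-join (inj₂ i) = ∈-++⁺ʳ R₁ (∈-resp-↭ (↭-sym (Rotation.↭-rotated r₂)) i)
    R₁++R₂≡ : R₁ ++ R₂ ≡ y₁ ∷ (M₁ ++ x₁ ∷ (y₂ ∷ M₂ ++ x₂ ∷ []))
    R₁++R₂≡ = cong (y₁ ∷_) (++-assoc M₁ (x₁ ∷ []) R₂)
    adjacent : ∀ {p q} → Succ (R₁ ++ R₂) p q → E p q
    adjacent (inj₁ c) with Consecutive-++⁻ R₁ R₂ c
    ... | inj₁ c′ = IsCycle.adjacent c₁ (Rotation.sound r₁ c′)
    ... | inj₂ (inj₁ c′) = IsCycle.adjacent c₂ (Rotation.sound r₂ c′)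
    ... | inj₂ (inj₂ ((P′ , e) , (Q′ , f))) with ∷ʳ-injective (y₁ ∷ M₁) P′ e | ∷-injective f
    ... | _ , refl | refl , _ = x₁y₂
    adjacent (inj₂ (B , e)) with ∷-injective e
    ... | refl , e′ with ∷ʳ-injective (M₁ ++ x₁ ∷ y₂ ∷ M₂) B
                           (trans (++-assoc M₁ (x₁ ∷ y₂ ∷ M₂) (x₂ ∷ []))
                                  (trans (sym (++-assoc M₁ (x₁ ∷ []) R₂)) e′))
    ... | _ , refl = x₂y₁
    length≥3 : ∀ (M : List V) {x y R} → 3 ≤ length (y₁ ∷ (M ++ x ∷ y ∷ R))
    length≥3 [] = s≤s (s≤s (s≤s z≤n))
    length≥3 (_ ∷ M) = ≤-trans (length≥3 M) (n≤1+n _)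
    isCycle : IsCycle (R₁ ++ R₂)
    isCycle = record
      { unique = Unique.++⁺ (Unique-resp-↭ (↭-sym (Rotation.↭-rotated r₁)) (IsCycle.unique c₁))
                            (Unique-resp-↭ (↭-sym (Rotation.↭-rotated r₂)) (IsCycle.unique c₂))
                            (λ (i , j) → disjoint (∈-resp-↭ (Rotation.↭-rotated r₁) i)
                                                  (∈-resp-↭ (Rotation.↭-rotated r₂) j))
      ; length≥3 = subst (λ z → 3 ≤ length z) (sym R₁++R₂≡) (length≥3 M₁)
      ; adjacent = adjacent }

  SuccsKept⇒EdgesKept : ∀ {l L x y u v} → SameEdge x y u v → SuccsKept l x y L → EdgesKept l u v L
  SuccsKept⇒EdgesKept (inj₁ (refl , refl)) kept (inj₁ s) ne = inj₁ (kept s λ (p≡ , q≡) → ne (inj₁ (p≡ , q≡)))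
  SuccsKept⇒EdgesKept (inj₁ (refl , refl)) kept (inj₂ s) ne = inj₂ (kept s λ (q≡ , p≡) → ne (inj₂ (p≡ , q≡)))
  SuccsKept⇒EdgesKept (inj₂ (refl , refl)) kept (inj₁ s) ne = inj₁ (kept s λ (p≡ , q≡) → ne (inj₂ (p≡ , q≡)))
  SuccsKept⇒EdgesKept (inj₂ (refl , refl)) kept (inj₂ s) ne = inj₂ (kept s λ (q≡ , p≡) → ne (inj₁ (p≡ , q≡)))

  Joined-map : ∀ {l₁ l₂ K₁ K₂ K₁′ K₂′} → (∀ {L} → K₁ L → K₁′ L) → (∀ {L} → K₂ L → K₂′ L) →
               Joined l₁ l₂ K₁ K₂ → Joined l₁ l₂ K₁′ K₂′
  Joined-map f g J = record
    { joined = joined ; isCycle = isCycle ; ∈-joined = ∈-joined ; keptˡ = f keptˡ ; keptʳ = g keptʳ }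
    where open Joined J

  Joined-unreverseʳ : ∀ {l₁ l₂ K u v} → Joined l₁ (reverse l₂) K (EdgesKept (reverse l₂) u v) →
                      Joined l₁ l₂ K (EdgesKept l₂ u v)
  Joined-unreverseʳ {l₂ = l₂} J = record
    { joined = joined ; isCycle = isCycle
    ; ∈-joined = mk⇔ (λ i → map₂ (∈-resp-↭ (↭-reverse l₂)) (Equivalence.to ∈-joined i))
                     (λ i → Equivalence.from ∈-joined (map₂ (∈-resp-↭ (↭-sym (↭-reverse l₂))) i))
    ; keptˡ = keptˡ ; keptʳ = λ e ne → keptʳ (Edge-reverse⁺ e) ne }
    where open Joined J

  joinEdges : ∀ {l₁ l₂ u v u′ v′} → IsCycle l₁ → IsCycle l₂ → Disjoint l₁ l₂ →
              Edge l₁ u v → Edge l₂ u′ v′ → E u u′ → E v v′ →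
              Joined l₁ l₂ (EdgesKept l₁ u v) (EdgesKept l₂ u′ v′)
  joinEdges c₁ c₂ dj (inj₁ s₁) (inj₂ s₂) uu′ vv′ =
    Joined-map (SuccsKept⇒EdgesKept (inj₁ (refl , refl))) (SuccsKept⇒EdgesKept (inj₂ (refl , refl)))
               (joinSuccs c₁ c₂ dj s₁ s₂ uu′ (E-sym vv′))
  joinEdges c₁ c₂ dj (inj₂ s₁) (inj₁ s₂) uu′ vv′ =
    Joined-map (SuccsKept⇒EdgesKept (inj₂ (refl , refl))) (SuccsKept⇒EdgesKept (inj₁ (refl , refl)))
               (joinSuccs c₁ c₂ dj s₁ s₂ vv′ (E-sym uu′))
  joinEdges {l₂ = l₂} c₁ c₂ dj (inj₁ s₁) (inj₁ s₂) uu′ vv′ =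
    Joined-unreverseʳ (joinEdges c₁ (IsCycle-reverse c₂) (λ i j → dj i (∈-resp-↭ (↭-reverse l₂) j))
                                 (inj₁ s₁) (inj₂ (Succ-reverse s₂)) uu′ vv′)
  joinEdges {l₂ = l₂} c₁ c₂ dj (inj₂ s₁) (inj₂ s₂) uu′ vv′ =
    Joined-unreverseʳ (joinEdges c₁ (IsCycle-reverse c₂) (λ i j → dj i (∈-resp-↭ (↭-reverse l₂) j))
                                 (inj₂ s₁) (inj₁ (Succ-reverse s₂)) uu′ vv′)

module Enumeration {V : Set} (E : V → V → Set) (E-sym : ∀ {x y} → E x y → E y x) where

  open import Data.Nat using (zero; suc; _≤_; s≤s; z≤n)
  open import Data.Nat.Properties using (≤-pred; ≤-trans)
  open import Data.Fin using (Fin; fromℕ; inject₁) renaming (zero to fzero; suc to fsuc)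
  open import Data.List using (List; []; _∷_; tabulate; length; lookup)
  open import Data.List.Properties using (length-tabulate; tabulate-lookup; ∷-injective; ∷ʳ-injective)
  open import Data.List.Membership.Propositional using (_∈_)
  open import Data.List.Membership.Propositional.Properties using (∈-lookup)
  open import Data.List.Relation.Unary.Any using (index)
  open import Data.List.Relation.Unary.Any.Properties using (lookup-index)
  import Data.List.Relation.Unary.All as All
  open import Data.List.Relation.Unary.AllPairs using (AllPairs; _∷_)
  import Data.List.Relation.Unary.Unique.Propositional.Properties as Unique
  open import Data.Product using (Σ; _×_; _,_; proj₁; proj₂)
  open import Data.Sum using (inj₁; inj₂)
  open import Data.Empty using (⊥-elim)
  open import Function.Definitions using (Injective)
  open import Relation.Binary.PropositionalEquality
  open CyclicList
  open Cycle E E-sym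

  private
    Consecutive-tabulate : ∀ m (f : Fin (suc m) → V) (i : Fin m) →
                           Consecutive (tabulate f) (f (inject₁ i)) (f (fsuc i))
    Consecutive-tabulate (suc m) f fzero = [] , tabulate (λ z → f (fsuc (fsuc z))) , refl
    Consecutive-tabulate (suc m) f (fsuc i) with Consecutive-tabulate m (λ z → f (fsuc z)) i
    ... | A , B , e = f fzero ∷ A , B , cong (f fzero ∷_) e

    EndsWith-tabulate : ∀ m (f : Fin (suc m) → V) → EndsWith (tabulate f) (f (fromℕ m))
    EndsWith-tabulate zero f = [] , refl
    EndsWith-tabulate (suc m) f with EndsWith-tabulate m (λ z → f (fsuc z))
    ... | B , e = f fzero ∷ B , cong (f fzero ∷_) e

    Consecutive-tabulate⁻ : ∀ m (f : Fin (suc m) → V) {x y} → Consecutive (tabulate f) x y →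
                            Σ (Fin m) λ i → x ≡ f (inject₁ i) × y ≡ f (fsuc i)
    Consecutive-tabulate⁻ (suc m) f ([] , B , e) with ∷-injective e
    ... | e₁ , e₂ = fzero , sym e₁ , sym (proj₁ (∷-injective e₂))
    Consecutive-tabulate⁻ (suc m) f (_ ∷ A , B , e)
      with Consecutive-tabulate⁻ m (λ z → f (fsuc z)) (A , B , proj₂ (∷-injective e))
    ... | i , e₁ , e₂ = fsuc i , e₁ , e₂
    Consecutive-tabulate⁻ zero f ([] , _ , ())
    Consecutive-tabulate⁻ zero f (_ ∷ [] , _ , ())
    Consecutive-tabulate⁻ zero f (_ ∷ _ ∷ _ , _ , ())

    Closing-tabulate⁻ : ∀ m (f : Fin (suc m) → V) {x y} → Closing (tabulate f) x y →
                        x ≡ f (fromℕ m) × y ≡ f fzero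
    Closing-tabulate⁻ m f {y = y} (B , e) with EndsWith-tabulate m f
    ... | B′ , e′ = proj₂ (∷ʳ-injective (y ∷ B) B′ (trans (sym e) e′)) , sym (proj₁ (∷-injective e))

  Succ-tabulate : ∀ m (f : Fin (suc m) → V) → 1 ≤ m → ∀ {i j} → CycSucc i j → Succ (tabulate f) (f i) (f j)
  Succ-tabulate m f _ (step i) = inj₁ (Consecutive-tabulate m f i)
  Succ-tabulate (suc m) f _ wrap with EndsWith-tabulate m (λ z → f (fsuc z))
  ... | B , e = inj₂ (B , cong (f fzero ∷_) e)

  IsCycle-tabulate : ∀ m (f : Fin (suc m) → V) → 2 ≤ m → Injective _≡_ _≡_ f →
                     (∀ i j → CycSucc i j → E (f i) (f j)) → IsCycle (tabulate f)
  IsCycle-tabulate m f m≥2 injective adjacent = record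
    { unique = Unique.tabulate⁺ injective
    ; length≥3 = subst (3 ≤_) (sym (length-tabulate f)) (s≤s m≥2)
    ; adjacent = adjacent′ }
    where
    adjacent′ : ∀ {x y} → Succ (tabulate f) x y → E x y
    adjacent′ (inj₁ c) with Consecutive-tabulate⁻ m f c
    ... | i , refl , refl = adjacent _ _ (step i)
    adjacent′ (inj₂ c) with Closing-tabulate⁻ m f c
    ... | refl , refl = adjacent _ _ wrap

  private
    lookup-injective : ∀ (l : List V) → AllPairs _≢_ l → Injective _≡_ _≡_ (lookup l)
    lookup-injective (h ∷ t) (_ ∷ u) {fzero} {fzero} e = refl
    lookup-injective (h ∷ t) (h∉t ∷ u) {fzero} {fsuc j} e = ⊥-elim (All.lookup h∉t (∈-lookup j) e)
    lookup-injective (h ∷ t) (h∉t ∷ u) {fsuc i} {fzero} e = ⊥-elim (All.lookup h∉t (∈-lookup i) (sym e))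
    lookup-injective (h ∷ t) (_ ∷ u) {fsuc i} {fsuc j} e = cong fsuc (lookup-injective t u e)

  toHamiltonian : ∀ {E′ : V → V → Set} → (∀ {x y} → E x y → E′ x y) →
                  ∀ l → IsCycle l → (∀ v → v ∈ l) → HamiltonianCycle E′
  toHamiltonian {E′} E⇒E′ l@(h ∷ t) c all = record
    { len-1 = length t
    ; len≥3 = ≤-pred (IsCycle.length≥3 c)
    ; cyc = lookup l
    ; injCyc = lookup-injective l (IsCycle.unique c)
    ; surjCyc = λ v → index (all v) , λ { refl → sym (lookup-index (all v)) }
    ; adjCyc = λ i j s → E⇒E′ (IsCycle.adjacent c
        (subst (λ l′ → Succ l′ (lookup l i) (lookup l j)) (tabulate-lookup l)
               (Succ-tabulate (length t) (lookup l) 1≤length s))) }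
    where
    1≤length : 1 ≤ length t
    1≤length = ≤-trans (s≤s z≤n) (≤-pred (IsCycle.length≥3 c))
  toHamiltonian _ [] c _ with () ← IsCycle.length≥3 c

module Neighbours {V : Set} where

  open import Data.Nat using (_≤_; s≤s; z≤n)
  open import Data.List using (List; []; _∷_; _++_; length; initLast; _∷ʳ′_)
  open import Data.List.Properties using (++-assoc)
  open import Data.List.Membership.Propositional using (_∈_)
  open import Data.List.Membership.Propositional.Properties using (∈-∃++; ∈-++⁺ʳ)
  open import Data.List.Relation.Unary.Any using (here)
  import Data.List.Relation.Unary.All as All
  open import Data.List.Relation.Unary.AllPairs using (_∷_)
  open import Data.List.Relation.Unary.Unique.Propositional using (Unique)
  open import Data.Product using (Σ; _×_; _,_)
  open import Data.Sum using (inj₁; inj₂)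
  open import Data.Empty using (⊥-elim)
  open import Relation.Nullary using (¬_)
  open import Relation.Binary.PropositionalEquality
  open CyclicList

  Neighbours : List V → V → Set
  Neighbours l v = Σ V λ p → Σ V λ s → Succ l p v × Succ l v s × p ≢ s

  private
    Unique-++⁻ʳ : ∀ (X : List V) {Y} → Unique (X ++ Y) → Unique Y
    Unique-++⁻ʳ [] u = u
    Unique-++⁻ʳ (_ ∷ X) (_ ∷ u) = Unique-++⁻ʳ X u

    repeated : ∀ (x : V) Y Z → ¬ Unique (x ∷ (Y ++ x ∷ Z))
    repeated x Y Z (x∉ ∷ _) = All.lookup x∉ (∈-++⁺ʳ Y (here refl)) refl

    too-short : ∀ {n} → 3 ≤ n → ¬ n ≤ 2
    too-short (s≤s (s≤s (s≤s _))) (s≤s (s≤s ()))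

  neighbours : ∀ (l : List V) {v} → Unique l → 3 ≤ length l → v ∈ l → Neighbours l v
  neighbours l {v} u l≥3 v∈l with ∈-∃++ v∈l
  ... | A , B , refl with initLast A | B
  ... | A′ ∷ʳ′ p | s ∷ B′ =
        p , s , inj₁ (A′ , s ∷ B′ , ++-assoc A′ (p ∷ []) _) , inj₁ (A′ ++ p ∷ [] , B′ , refl) ,
        λ { refl → repeated p (v ∷ []) B′ (Unique-++⁻ʳ A′ (subst Unique (++-assoc A′ (p ∷ []) _) u)) }
  ... | [] | s ∷ B′ with initLast B′
  ...   | [] = ⊥-elim (too-short l≥3 (s≤s (s≤s z≤n)))
  ...   | B″ ∷ʳ′ p = p , s , inj₂ (s ∷ B″ , refl) , inj₁ ([] , B″ ++ p ∷ [] , refl) ,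
                     λ { refl → repeated p B″ [] (Unique-++⁻ʳ (v ∷ []) u) }
  neighbours l {v} u l≥3 v∈l | A , B , refl | [] | [] = ⊥-elim (too-short l≥3 (s≤s z≤n))
  neighbours l {v} u l≥3 v∈l | A , B , refl | A′ ∷ʳ′ p | [] with A′
  ... | [] = ⊥-elim (too-short l≥3 (s≤s (s≤s z≤n)))
  ... | s ∷ A″ = p , s , inj₁ (s ∷ A″ , [] , ++-assoc (s ∷ A″) (p ∷ []) (v ∷ [])) , inj₂ (A″ ++ p ∷ [] , refl) ,
                 λ { refl → repeated s A″ (v ∷ []) (subst Unique (cong (s ∷_) (++-assoc A″ (s ∷ []) (v ∷ []))) u) }

module Walk (m₀ k₀ : ℕ) (m<k : suc m₀ ≤ k₀) (coprime : Coprime (suc (suc (m₀ + k₀))) (suc m₀)) where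

  open import Data.Nat
  open import Data.Nat.Properties
  open import Data.Nat.DivMod
  open import Data.Nat.Divisibility using (_∣_; divides; ∣⇒≤)
  open import Data.Nat.Coprimality using (coprime-divisor)
  open import Data.Nat.Tactic.RingSolver using (solve-∀)
  open import Data.Fin using (Fin; toℕ; fromℕ<; punchOut)
  open import Data.Fin.Properties using (toℕ-fromℕ<; toℕ<n; any?; punchOut-injective; injective⇒≤; toℕ-injective)
    renaming (_≟_ to _≟ᶠ_)
  open import Data.Product using (Σ; _×_; _,_)
  open import Data.Sum using (inj₁; inj₂)
  open import Data.Empty using (⊥-elim)
  open import Relation.Nullary using (yes; no)
  open import Relation.Binary.PropositionalEquality
  open import Relation.Binary.Definitions using (tri<; tri≈; tri>)
  open ≡-Reasoning

  m k N M : ℕ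
  m = suc m₀
  k = suc k₀
  N = suc (m₀ + k₀)
  M = suc N

  m+k≡M : m + k ≡ M
  m+k≡M = cong suc (+-suc m₀ k₀)

  -- walk j = (j + 1) m - 1 mod m + k steps up by m from below k and down by k from k on;
  -- coprimality makes it visit each of 0, …, m + k - 2 before reaching m + k - 1.
  walk : ℕ → ℕ
  walk j = (m₀ + j * m) % M

  private
    %-≡⇒∣∸ : ∀ A B {M} .{{_ : NonZero M}} → A % M ≡ B % M → M ∣ B ∸ A
    %-≡⇒∣∸ A B {M} eq = divides (B / M ∸ A / M) (begin
      B ∸ A                                            ≡⟨ cong₂ _∸_ (m≡m%n+[m/n]*n B M) (m≡m%n+[m/n]*n A M) ⟩
      (B % M + (B / M) * M) ∸ (A % M + (A / M) * M)     ≡⟨ cong (λ t → (t + (B / M) * M) ∸ (A % M + (A / M) * M)) (sym eq) ⟩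
      (A % M + (B / M) * M) ∸ (A % M + (A / M) * M)     ≡⟨ [m+n]∸[m+o]≡n∸o (A % M) _ _ ⟩
      (B / M) * M ∸ (A / M) * M                        ≡⟨ *-distribʳ-∸ M (B / M) (A / M) ⟨
      (B / M ∸ A / M) * M                              ∎)

  walk-injective : ∀ i j → i < j → j < M → walk i ≢ walk j
  walk-injective i j i<j j<M eq = <-irrefl refl (<-≤-trans j<M (≤-trans M≤j∸i (m∸n≤m j i)))
    where
    difference : (m₀ + j * m) ∸ (m₀ + i * m) ≡ m * (j ∸ i)
    difference = begin
      (m₀ + j * m) ∸ (m₀ + i * m)  ≡⟨ [m+n]∸[m+o]≡n∸o m₀ (j * m) (i * m) ⟩
      j * m ∸ i * m                ≡⟨ *-distribʳ-∸ m j i ⟨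
      (j ∸ i) * m                  ≡⟨ *-comm (j ∸ i) m ⟩
      m * (j ∸ i)                  ∎
    M∣j∸i : M ∣ j ∸ i
    M∣j∸i = coprime-divisor coprime (subst (M ∣_) difference (%-≡⇒∣∸ (m₀ + i * m) (m₀ + j * m) eq))
    M≤j∸i : M ≤ j ∸ i
    M≤j∸i = ∣⇒≤ {{>-nonZero (m<n⇒0<n∸m i<j)}} M∣j∸i

  walk-first : walk 0 ≡ m₀
  walk-first = trans (cong (_% M) (+-identityʳ m₀)) (m<n⇒m%n≡m (≤-trans (s≤s (m≤m+n m₀ k₀)) (n≤1+n _)))

  walk-last : walk (m₀ + k₀) ≡ k₀
  walk-last = begin
    (m₀ + (m₀ + k₀) * m) % M   ≡⟨ cong (_% M) (identity m₀ k₀) ⟩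
    (k₀ + m₀ * M) % M          ≡⟨ [m+kn]%n≡m%n k₀ m₀ M ⟩
    k₀ % M                     ≡⟨ m<n⇒m%n≡m (s≤s (≤-trans (m≤n+m k₀ m₀) (n≤1+n _))) ⟩
    k₀                         ∎
    where
    identity : ∀ m₀ k₀ → m₀ + (m₀ + k₀) * suc m₀ ≡ k₀ + m₀ * suc (suc (m₀ + k₀))
    identity = solve-∀

  walk<N : ∀ j → j < N → walk j < N
  walk<N j j<N with m<1+n⇒m<n∨m≡n (m%n<n (m₀ + j * m) M)
  ... | inj₁ p = p
  ... | inj₂ e = ⊥-elim (walk-injective j N j<N (n<1+n N) (trans e (sym walk-N)))
    where
    walk-N : walk N ≡ N
    walk-N = begin
      (m₀ + N * m) % M    ≡⟨ cong (_% M) (identity m₀ k₀) ⟩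
      (N + m₀ * M) % M    ≡⟨ [m+kn]%n≡m%n N m₀ M ⟩
      N % M               ≡⟨ m<n⇒m%n≡m (n<1+n N) ⟩
      N                   ∎
      where
      identity : ∀ m₀ k₀ → m₀ + suc (m₀ + k₀) * suc m₀ ≡ suc (m₀ + k₀) + m₀ * suc (suc (m₀ + k₀))
      identity = solve-∀

  private
    walk-suc : ∀ j → walk (suc j) ≡ (walk j + m) % M
    walk-suc j = begin
      (m₀ + (m + j * m)) % M   ≡⟨ cong (_% M) (identity m₀ m j) ⟩
      ((m₀ + j * m) + m) % M   ≡⟨ %-distribˡ-+ (m₀ + j * m) m M ⟩
      (walk j + m % M) % M     ≡⟨ cong (λ t → (walk j + t) % M) (m<n⇒m%n≡m (s≤s (s≤s (m≤m+n m₀ k₀)))) ⟩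
      (walk j + m) % M         ∎
      where
      identity : ∀ a b c → a + (b + c * b) ≡ (a + c * b) + b
      identity = solve-∀

  walk-up : ∀ j → walk j < k → walk (suc j) ≡ walk j + m
  walk-up j lt = trans (walk-suc j)
    (m<n⇒m%n≡m (subst (walk j + m <_) m+k≡M (subst (_< m + k) (+-comm m (walk j)) (+-monoʳ-< m lt))))

  walk-down : ∀ j → k ≤ walk j → walk (suc j) ≡ walk j ∸ k
  walk-down j k≤ = begin
    walk (suc j)             ≡⟨ walk-suc j ⟩
    (walk j + m) % M         ≡⟨ m≤n⇒[n∸m]%m≡n%m M≤ ⟨
    (walk j + m ∸ M) % M     ≡⟨ m<n⇒m%n≡m (subst (_< M) (sym wrapped) (≤-<-trans (m∸n≤m (walk j) k) (m%n<n (m₀ + j * m) M))) ⟩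
    walk j + m ∸ M           ≡⟨ wrapped ⟩
    walk j ∸ k               ∎
    where
    M≤ : M ≤ walk j + m
    M≤ = subst (_≤ walk j + m) (trans (+-comm k m) m+k≡M) (+-monoˡ-≤ m k≤)
    wrapped : walk j + m ∸ M ≡ walk j ∸ k
    wrapped = begin
      walk j + m ∸ M         ≡⟨ cong (walk j + m ∸_) m+k≡M ⟨
      walk j + m ∸ (m + k)   ≡⟨ cong (_∸ (m + k)) (+-comm (walk j) m) ⟩
      m + walk j ∸ (m + k)   ≡⟨ [m+n]∸[m+o]≡n∸o m (walk j) k ⟩
      walk j ∸ k             ∎

  private
    f : Fin N → Fin N
    f j = fromℕ< (walk<N (toℕ j) (toℕ<n j))
    f-injective : ∀ {i j} → f i ≡ f j → i ≡ j
    f-injective {i} {j} eq with <-cmp (toℕ i) (toℕ j)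
    ... | tri≈ _ e _ = toℕ-injective e
    ... | tri< lt _ _ = ⊥-elim (walk-injective (toℕ i) (toℕ j) lt (≤-trans (toℕ<n j) (n≤1+n _)) f-eq)
      where f-eq = trans (sym (toℕ-fromℕ< _)) (trans (cong toℕ eq) (toℕ-fromℕ< _))
    ... | tri> _ _ gt = ⊥-elim (walk-injective (toℕ j) (toℕ i) gt (≤-trans (toℕ<n i) (n≤1+n _)) (sym f-eq))
      where f-eq = trans (sym (toℕ-fromℕ< _)) (trans (cong toℕ eq) (toℕ-fromℕ< _))

  -- Pigeonhole: walk maps [0, N) injectively into [0, N).
  walk-surjective : ∀ w → w < N → Σ ℕ λ j → j < N × walk j ≡ w
  walk-surjective w w<N with any? (λ j → f j ≟ᶠ fromℕ< w<N)
  ... | yes (j , e) = toℕ j , toℕ<n j , trans (sym (toℕ-fromℕ< (walk<N (toℕ j) (toℕ<n j))))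
                                               (trans (cong toℕ e) (toℕ-fromℕ< w<N))
  ... | no ∄j = ⊥-elim (<-irrefl refl (injective⇒≤ g-injective))
    where
    g : Fin N → Fin (m₀ + k₀)
    g j = punchOut {i = fromℕ< w<N} (λ e → ∄j (j , sym e))
    g-injective : ∀ {i j} → g i ≡ g j → i ≡ j
    g-injective {i} {j} e = f-injective (punchOut-injective (λ e → ∄j (i , sym e)) (λ e → ∄j (j , sym e)) e)

data Role : Set where
  α α′ β β′ : Role

data Partners : Role → Role → Set where
  α-α′ : Partners α α′
  α′-α : Partners α′ α
  β-β′ : Partners β β′
  β′-β : Partners β′ β

module Knight (a b n : ℕ) where

  open import Data.Nat using (suc; _+_; _∸_; _≤_; ∣_-_∣)
  open import Data.Nat.Properties using (∣-∣-comm; ∣m-m+n∣≡n; m≤n⇒∣n-m∣≡n∸m; m∸n≤m; m∸[m∸n]≡n)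
  open import Data.Fin using (Fin; toℕ) renaming (zero to fzero; suc to fsuc)
  open import Data.Fin.Properties using (suc-injective)
  open import Data.Vec using (lookup; _∷_)
  open import Data.List using (List)
  open import Data.List.Membership.Propositional using (_∈_)
  open import Data.Product using (Σ; _×_; _,_)
  open import Data.Sum using (_⊎_; inj₁; inj₂)
  import Data.Sum
  open import Data.Empty using (⊥-elim)
  open import Relation.Nullary using (¬_)
  open import Relation.Binary.PropositionalEquality
  open CyclicList

  -- A record wrapper, so that the endpoints can be inferred from an adjacency proof.
  record Adj (d : ℕ) (x y : Point n d) : Set where
    constructor adj
    field knightAdj : KnightAdj a b n d x y

  Adj-sym : ∀ {d x y} → Adj d x y → Adj d y x
  Adj-sym {y = y} (adj (i , j , i≢j , ea , eb , rest)) =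
    adj (i , j , i≢j , trans (∣-∣-comm (toℕ (lookup y i)) _) ea ,
         trans (∣-∣-comm (toℕ (lookup y j)) _) eb , λ k k≢i k≢j → sym (rest k k≢i k≢j))

  Adj-lift : ∀ {d} (z : Fin n) {u v} → Adj d u v → Adj (suc d) (z ∷ u) (z ∷ v)
  Adj-lift z (adj (i , j , i≢j , ea , eb , rest)) =
    adj (fsuc i , fsuc j , (λ e → i≢j (suc-injective e)) , ea , eb , rest′)
    where
    rest′ : ∀ k → k ≢ fsuc i → k ≢ fsuc j → _
    rest′ fzero _ _ = refl
    rest′ (fsuc k) k≢i k≢j = rest k (λ e → k≢i (cong fsuc e)) (λ e → k≢j (cong fsuc e))

  Differ : (d c : ℕ) → Point n d → Point n d → Set
  Differ d c u v = Σ (Fin d) λ i → ∣ toℕ (lookup u i) - toℕ (lookup v i) ∣ ≡ c ×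
                     (∀ k → k ≢ i → lookup u k ≡ lookup v k)

  Differ-lift : ∀ {d c} (z : Fin n) {u v} → Differ d c u v → Differ (suc d) c (z ∷ u) (z ∷ v)
  Differ-lift z (i , e , rest) = fsuc i , e , rest′
    where
    rest′ : ∀ k → k ≢ fsuc i → _
    rest′ fzero _ = refl
    rest′ (fsuc k) k≢i = rest k (λ e → k≢i (cong fsuc e))

  Adj-acrossᵃ : ∀ {d} {u v : Point n d} (z z′ : Fin n) → Differ d b u v → ∣ toℕ z - toℕ z′ ∣ ≡ a →
                Adj (suc d) (z ∷ u) (z′ ∷ v)
  Adj-acrossᵃ z z′ (i , eb , rest) ea = adj (fzero , fsuc i , (λ ()) , ea , eb , rest′)
    where
    rest′ : ∀ k → k ≢ fzero → k ≢ fsuc i → _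
    rest′ fzero k≢0 _ = ⊥-elim (k≢0 refl)
    rest′ (fsuc k) _ k≢i = rest k (λ e → k≢i (cong fsuc e))

  Adj-acrossᵇ : ∀ {d} {u v : Point n d} (z z′ : Fin n) → Differ d a u v → ∣ toℕ z - toℕ z′ ∣ ≡ b →
                Adj (suc d) (z ∷ u) (z′ ∷ v)
  Adj-acrossᵇ z z′ (i , ea , rest) eb = adj (fsuc i , fzero , (λ ()) , ea , eb , rest′)
    where
    rest′ : ∀ k → k ≢ fsuc i → k ≢ fzero → _
    rest′ fzero _ k≢0 = ⊥-elim (k≢0 refl)
    rest′ (fsuc k) k≢i _ = rest k (λ e → k≢i (cong fsuc e))

  Gap : ℕ → ℕ → Set
  Gap w w′ = ∣ w - w′ ∣ ≡ a ⊎ ∣ w - w′ ∣ ≡ b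

  ∣m-m∸n∣≡n : ∀ m {n} → n ≤ m → ∣ m - m ∸ n ∣ ≡ n
  ∣m-m∸n∣≡n m {n} n≤m = trans (m≤n⇒∣n-m∣≡n∸m (m∸n≤m m n)) (m∸[m∸n]≡n n≤m)

  Gap-+ : ∀ w {c} → c ≡ a ⊎ c ≡ b → Gap w (w + c)
  Gap-+ w {c} = Data.Sum.map (trans (∣m-m+n∣≡n w c)) (trans (∣m-m+n∣≡n w c))

  Gap-∸ : ∀ w {c} → c ≡ a ⊎ c ≡ b → c ≤ w → Gap w (w ∸ c)
  Gap-∸ w c∈ c≤w = Data.Sum.map (trans (∣m-m∸n∣≡n w c≤w)) (trans (∣m-m∸n∣≡n w c≤w)) c∈

  Gap-sym : ∀ {w w′} → Gap w w′ → Gap w′ w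
  Gap-sym {w} {w′} (inj₁ e) = inj₁ (trans (∣-∣-comm w′ w) e)
  Gap-sym {w} {w′} (inj₂ e) = inj₂ (trans (∣-∣-comm w′ w) e)

  -- Copies of the edges x — y and x′ — y′ in two layers at gap a or b can be exchanged for two
  -- edges between the layers.
  Crossable : ∀ {d} → (x y x′ y′ : Point n d) → Set
  Crossable {d} x y x′ y′ = Differ d b x x′ × Differ d b y y′ × Differ d a x y′ × Differ d a y x′

  Crossing : ∀ {d} → Point n (suc d) → Point n (suc d) → Point n (suc d) → Point n (suc d) → Set
  Crossing {d} x y x′ y′ = (Adj (suc d) x x′ × Adj (suc d) y y′) ⊎ (Adj (suc d) x y′ × Adj (suc d) y x′)

  crossing : ∀ {d} {x y x′ y′ : Point n d} → Crossable x y x′ y′ → (z z′ : Fin n) → Gap (toℕ z) (toℕ z′) →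
             Crossing (z ∷ x) (z ∷ y) (z′ ∷ x′) (z′ ∷ y′)
  crossing (bx , by , _ , _) z z′ (inj₁ ea) = inj₁ (Adj-acrossᵃ z z′ bx ea , Adj-acrossᵃ z z′ by ea)
  crossing (_ , _ , ax , ay) z z′ (inj₂ eb) = inj₂ (Adj-acrossᵇ z z′ ax eb , Adj-acrossᵇ z z′ ay eb)

  Crossing-sym : ∀ {d} {x y x′ y′ : Point n (suc d)} → Crossing x y x′ y′ → Crossing x′ y′ x y
  Crossing-sym (inj₁ (p , q)) = inj₁ (Adj-sym p , Adj-sym q)
  Crossing-sym (inj₂ (p , q)) = inj₂ (Adj-sym q , Adj-sym p)

  KnightCycle : (d : ℕ) → List (Point n d) → Set
  KnightCycle d = Cycle.IsCycle (Adj d) Adj-sym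

  -- In dimension 2, α is the link {(0, b), (a, 0)}, α′ = {(0, 0), (a, b)}, β is the link
  -- {(n - 1, a), (n - b - 1, 0)} and β′ = {(n - b - 1, a), (n - 1, 0)}.
  record LinkedCycle (d : ℕ) : Set where
    field
      cycle    : List (Point n d)
      isCycle  : KnightCycle d cycle
      spanning : ∀ v → v ∈ cycle
      ex ey    : Role → Point n d
      edge     : ∀ r → Edge cycle (ex r) (ey r)
      distinct : ∀ r s → r ≢ s → ¬ SameEdge (ex r) (ey r) (ex s) (ey s)
      crossableα : Crossable (ex α) (ey α) (ex α′) (ey α′)
      crossableβ : Crossable (ex β) (ey β) (ex β′) (ey β′)

    crossing-partners : ∀ {r r′} → Partners r r′ → (z z′ : Fin n) → Gap (toℕ z) (toℕ z′) →
                        Crossing (z ∷ ex r) (z ∷ ey r) (z′ ∷ ex r′) (z′ ∷ ey r′)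
    crossing-partners α-α′ z z′ g = crossing crossableα z z′ g
    crossing-partners β-β′ z z′ g = crossing crossableβ z z′ g
    crossing-partners α′-α z z′ g = Crossing-sym (crossing crossableα z′ z (Gap-sym {toℕ z} {toℕ z′} g))
    crossing-partners β′-β z z′ g = Crossing-sym (crossing crossableβ z′ z (Gap-sym {toℕ z} {toℕ z′} g))

  SameEdge-∷⁻ : ∀ {d} {z z′ : Fin n} {p q u v : Point n d} →
                SameEdge {Point n (suc d)} (z ∷ p) (z ∷ q) (z′ ∷ u) (z′ ∷ v) → SameEdge p q u v × z ≡ z′
  SameEdge-∷⁻ (inj₁ (refl , refl)) = inj₁ (refl , refl) , refl
  SameEdge-∷⁻ (inj₂ (refl , refl)) = inj₂ (refl , refl) , refl

  module Layers {d : ℕ} (G : LinkedCycle d) where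

    open import Data.Nat using (_<_)
    open import Data.Fin using (fromℕ<)
    open import Data.Fin.Properties using (toℕ-injective; toℕ<n; toℕ-fromℕ<)
    open import Data.Vec using (head)
    open import Data.Vec.Properties using (∷-injectiveʳ)
    open import Data.List using (map)
    open import Data.List.Properties using (length-map)
    open import Data.List.Membership.Propositional.Properties using (∈-map⁺; ∈-map⁻)
    import Data.List.Relation.Unary.Unique.Propositional.Properties as Unique
    open import Data.Product using (proj₁)
    open import Function using (Equivalence)
    open LinkedCycle G hiding (isCycle)
    open Cycle (Adj (suc d)) Adj-sym using (Joined; joinEdges)

    Point′ : Set
    Point′ = Point n (suc d)

    layer : Fin n → List Point′
    layer z = map (z ∷_) cycle

    layer-isCycle : ∀ z → KnightCycle (suc d) (layer z)
    layer-isCycle z = record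
      { unique = Unique.map⁺ ∷-injectiveʳ unique
      ; length≥3 = subst (3 ≤_) (sym (length-map (z ∷_) cycle)) length≥3
      ; adjacent = adjacent′ }
      where
      open Cycle.IsCycle (LinkedCycle.isCycle G)
      adjacent′ : ∀ {x y} → Succ (layer z) x y → Adj (suc d) x y
      adjacent′ s with Succ-map⁻ (z ∷_) cycle s
      ... | _ , _ , refl , refl , s′ = Adj-lift z (adjacent s′)

    ∈-layer⁻ : ∀ {z} {v : Point′} → v ∈ layer z → head v ≡ z
    ∈-layer⁻ i with ∈-map⁻ _ i
    ... | _ , _ , refl = refl

    ∈-layer⁺ : ∀ {z} (u : Point n d) → (z ∷ u) ∈ layer z
    ∈-layer⁺ u = ∈-map⁺ _ (spanning u)

    layer-edge : ∀ z r → Edge (layer z) (z ∷ ex r) (z ∷ ey r)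
    layer-edge z r = Edge-map⁺ (z ∷_) (edge r)

    -- Used w r: the copy of the edge r in layer w may have been removed by a join.
    record Assembly (C : List Point′) (Covered : ℕ → Set) (Used : ℕ → Role → Set) : Set where
      field
        isCycle   : KnightCycle (suc d) C
        covered⁻  : ∀ {v : Point′} → v ∈ C → Covered (toℕ (head v))
        covered⁺  : ∀ (v : Point′) → Covered (toℕ (head v)) → v ∈ C
        available : ∀ (z : Fin n) r → Covered (toℕ z) → ¬ Used (toℕ z) r → Edge C (z ∷ ex r) (z ∷ ey r)

    Assembled : (Covered : ℕ → Set) (Used : ℕ → Role → Set) → Set
    Assembled Covered Used = Σ (List Point′) λ C → Assembly C Covered Used

    Assembled-resp : ∀ {P Q : ℕ → Set} {U U′ : ℕ → Role → Set} →
                     (∀ w → P w → Q w) → (∀ w → Q w → P w) → (∀ w r → U w r → U′ w r) →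
                     Assembled P U → Assembled Q U′
    Assembled-resp P⇒Q Q⇒P U⇒U′ (C , A) = C , record
      { isCycle = isCycle
      ; covered⁻ = λ i → P⇒Q _ (covered⁻ i)
      ; covered⁺ = λ v q → covered⁺ v (Q⇒P _ q)
      ; available = λ z r q ¬u′ → available z r (Q⇒P _ q) (λ u → ¬u′ (U⇒U′ _ r u)) }
      where open Assembly A

    singleLayer : ∀ (z : Fin n) (Used : ℕ → Role → Set) → Assembled (_≡ toℕ z) Used
    singleLayer z Used = layer z , record
      { isCycle = layer-isCycle z
      ; covered⁻ = λ i → cong toℕ (∈-layer⁻ i)
      ; covered⁺ = λ { (w ∷ u) e → subst (λ t → (t ∷ u) ∈ layer z) (sym (toℕ-injective e)) (∈-layer⁺ u) }
      ; available = λ z′ r e _ → subst (λ t → Edge (layer z) (t ∷ ex r) (t ∷ ey r))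
                                       (sym (toℕ-injective e)) (layer-edge z r) }

    private
      extendᶠ : ∀ {Covered Used} → Assembled Covered Used →
                (z z′ : Fin n) → ∀ {w w′} → toℕ z ≡ w → toℕ z′ ≡ w′ →
                ¬ Covered w → Covered w′ → Gap w′ w → ∀ {r′ r} → Partners r′ r → ¬ Used w′ r′ →
                (Used′ : ℕ → Role → Set) → (∀ v s → v ≢ w → Used v s → Used′ v s) → Used′ w′ r′ → Used′ w r →
                Assembled (λ v → Covered v ⊎ v ≡ w) Used′
      extendᶠ {Covered} {Used} (C , A) z z′ refl refl ¬Pz Pz′ gap {r′} {r} partners ¬Uz′r′ Used′ U⇒U′ U′z′r′ U′zr =
        fromCrossing (crossing-partners partners z′ z gap)
        where
        open Assembly A
        open Cycle (Adj (suc d)) Adj-sym using (Disjoint; EdgesKept)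
        disjoint : Disjoint C (layer z)
        disjoint i j = ¬Pz (subst (λ t → Covered (toℕ t)) (∈-layer⁻ j) (covered⁻ i))
        fromJoined : ∀ {u′ v′} → SameEdge u′ v′ (z ∷ ex r) (z ∷ ey r) →
                     Joined C (layer z) (EdgesKept C (z′ ∷ ex r′) (z′ ∷ ey r′)) (EdgesKept (layer z) u′ v′) →
                     Assembled (λ v → Covered v ⊎ v ≡ toℕ z) Used′
        fromJoined same J = joined , record
          { isCycle = Joined.isCycle J
          ; covered⁻ = λ i → Data.Sum.map covered⁻ (λ j → cong toℕ (∈-layer⁻ j)) (Equivalence.to ∈-joined i)
          ; covered⁺ = covered⁺′
          ; available = available′ }
          where
          open Joined J
          covered⁺′ : ∀ v → Covered (toℕ (head v)) ⊎ toℕ (head v) ≡ toℕ z → v ∈ joined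
          covered⁺′ v (inj₁ p) = Equivalence.from ∈-joined (inj₁ (covered⁺ v p))
          covered⁺′ (x ∷ u) (inj₂ e) = Equivalence.from ∈-joined
            (inj₂ (subst (λ t → (t ∷ u) ∈ layer z) (sym (toℕ-injective e)) (∈-layer⁺ u)))
          -- Only the copies of r′ in layer z′ and of r in layer z were deleted, and Used′ records both.
          available′ : ∀ z″ s → Covered (toℕ z″) ⊎ toℕ z″ ≡ toℕ z → ¬ Used′ (toℕ z″) s →
                       Edge joined (z″ ∷ ex s) (z″ ∷ ey s)
          available′ z″ s (inj₁ p) ¬U′ =
            keptˡ (available z″ s p λ u → ¬U′ (U⇒U′ _ s (λ e → ¬Pz (subst Covered e p)) u))
                  λ same′ → let (tails , heads) = SameEdge-∷⁻ same′ in
                    distinct s r′ (λ { refl → ¬U′ (subst (λ t → Used′ (toℕ t) s) (sym heads) U′z′r′) }) tails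
          available′ z″ s (inj₂ e) ¬U′ with toℕ-injective e
          ... | refl = keptʳ (layer-edge z s) λ same′ →
                  distinct s r (λ { refl → ¬U′ U′zr }) (proj₁ (SameEdge-∷⁻ (SameEdge-trans same′ same)))
        fromCrossing : Crossing (z′ ∷ ex r′) (z′ ∷ ey r′) (z ∷ ex r) (z ∷ ey r) →
                       Assembled (λ v → Covered v ⊎ v ≡ toℕ z) Used′
        fromCrossing (inj₁ (e₁ , e₂)) = fromJoined (inj₁ (refl , refl))
          (joinEdges isCycle (layer-isCycle z) disjoint (available z′ r′ Pz′ ¬Uz′r′) (layer-edge z r) e₁ e₂)
        fromCrossing (inj₂ (e₁ , e₂)) = fromJoined (inj₂ (refl , refl))
          (joinEdges isCycle (layer-isCycle z) disjoint (available z′ r′ Pz′ ¬Uz′r′) (Edge-sym (layer-edge z r)) e₁ e₂)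

    extend : ∀ {Covered Used} → Assembled Covered Used →
             ∀ {w w′} → w < n → w′ < n → ¬ Covered w → Covered w′ → Gap w′ w →
             ∀ {r′ r} → Partners r′ r → ¬ Used w′ r′ →
             (Used′ : ℕ → Role → Set) → (∀ v s → v ≢ w → Used v s → Used′ v s) → Used′ w′ r′ → Used′ w r →
             Assembled (λ v → Covered v ⊎ v ≡ w) Used′
    extend A w<n w′<n = extendᶠ A (fromℕ< w<n) (fromℕ< w′<n) (toℕ-fromℕ< w<n) (toℕ-fromℕ< w′<n)

    relink : ∀ {Used} → Assembled (_< n) Used → (zα zβ : Fin n) →
             ¬ Used (toℕ zα) α → ¬ Used (toℕ zα) α′ → ¬ Used (toℕ zβ) β → ¬ Used (toℕ zβ) β′ →
             LinkedCycle (suc d)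
    relink (C , A) zα zβ free-α free-α′ free-β free-β′ = record
      { cycle = C ; isCycle = isCycle ; spanning = λ v → covered⁺ v (toℕ<n (head v))
      ; ex = λ r → layerOf r ∷ ex r ; ey = λ r → layerOf r ∷ ey r ; edge = edge′
      ; distinct = λ r s r≢s same → distinct r s r≢s (proj₁ (SameEdge-∷⁻ same))
      ; crossableα = Crossable-lift zα crossableα ; crossableβ = Crossable-lift zβ crossableβ }
      where
      open Assembly A
      layerOf : Role → Fin n
      layerOf α = zα
      layerOf α′ = zα
      layerOf β = zβ
      layerOf β′ = zβ
      edge′ : ∀ r → Edge C (layerOf r ∷ ex r) (layerOf r ∷ ey r)
      edge′ α = available zα α (toℕ<n zα) free-α
      edge′ α′ = available zα α′ (toℕ<n zα) free-α′
      edge′ β = available zβ β (toℕ<n zβ) free-β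
      edge′ β′ = available zβ β′ (toℕ<n zβ) free-β′
      Crossable-lift : ∀ (z : Fin n) {x y x′ y′ : Point n d} → Crossable x y x′ y′ →
                       Crossable (z ∷ x) (z ∷ y) (z ∷ x′) (z ∷ y′)
      Crossable-lift z (bx , by , ax , ay) = Differ-lift z bx , Differ-lift z by , Differ-lift z ax , Differ-lift z ay

  LinkedCycle⇒KnightTour : ∀ {d} → LinkedCycle d → KnightTour a b n d
  LinkedCycle⇒KnightTour {d} G = Enumeration.toHamiltonian (Adj d) Adj-sym Adj.knightAdj cycle isCycle spanning
    where open LinkedCycle G

module StepSizes where

  open import Data.Nat
  open import Data.Nat.Properties using (<-cmp; +-suc; +-comm; ≤-pred)
  open import Data.Nat.Coprimality using (Coprime; coprime-+)
  import Data.Nat.Coprimality as Coprime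
  open import Data.Sum using (_⊎_; inj₁; inj₂)
  open import Data.Empty using (⊥-elim)
  open import Relation.Binary.PropositionalEquality
  open import Relation.Binary.Definitions using (tri<; tri≈; tri>)

  -- m = m₀ + 1 and k = k₀ + 1 are a and b in increasing order.
  record Steps (a b n₁ : ℕ) : Set where
    field
      m₀ k₀   : ℕ
      m<k     : suc m₀ ≤ k₀
      coprime : Coprime (suc (suc (m₀ + k₀))) (suc m₀)
      m-step  : suc m₀ ≡ a ⊎ suc m₀ ≡ b
      k-step  : suc k₀ ≡ a ⊎ suc k₀ ≡ b
      N≤n₁    : suc (m₀ + k₀) ≤ n₁

  private
    sum-coprime : ∀ x y → Coprime (suc y) (suc x) → Coprime (suc (suc (x + y))) (suc x)
    sum-coprime x y c = subst (λ t → Coprime t (suc x)) (cong suc (+-suc x y)) (coprime-+ c)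

    fits : ∀ {n₁} x y → suc x + suc y ≤ suc n₁ → suc (x + y) ≤ n₁
    fits {n₁} x y le = subst (_≤ n₁) (+-suc x y) (≤-pred le)

  steps : ∀ a₀ b₀ n₁ → suc a₀ ≢ suc b₀ → Coprime (suc a₀) (suc b₀) → suc a₀ + suc b₀ ≤ suc n₁ →
          Steps (suc a₀) (suc b₀) n₁
  steps a₀ b₀ n₁ a≢b coprime a+b≤n with <-cmp a₀ b₀
  ... | tri< a<b _ _ = record
    { m₀ = a₀ ; k₀ = b₀ ; m<k = a<b ; coprime = sum-coprime a₀ b₀ (Coprime.sym coprime)
    ; m-step = inj₁ refl ; k-step = inj₂ refl ; N≤n₁ = fits a₀ b₀ a+b≤n }
  ... | tri≈ _ refl _ = ⊥-elim (a≢b refl)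
  ... | tri> _ _ b<a = record
    { m₀ = b₀ ; k₀ = a₀ ; m<k = b<a ; coprime = sum-coprime b₀ a₀ coprime
    ; m-step = inj₂ refl ; k-step = inj₁ refl ; N≤n₁ = fits b₀ a₀ (subst (_≤ suc n₁) (+-comm (suc a₀) (suc b₀)) a+b≤n) }

open StepSizes

module Extension (a b n₁ : ℕ) (S : Steps a b n₁) {d : ℕ} (G : Knight.LinkedCycle a b (suc n₁) d) where

  open import Data.Nat
  open import Data.Nat.Properties
  open import Data.Fin using (fromℕ; fromℕ<)
  open import Data.Fin.Properties using (toℕ-fromℕ; toℕ-fromℕ<)
  open import Data.Product using (Σ; _×_; _,_; proj₁; proj₂)
  open import Data.Sum using (_⊎_; inj₁; inj₂)
  open import Relation.Nullary using (¬_; Dec; yes; no)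
  open import Relation.Binary.PropositionalEquality

  n : ℕ
  n = suc n₁

  open Steps S
  open Knight a b n
  open Layers G
  open Walk m₀ k₀ m<k coprime

  <N⇒<n : ∀ {w} → w < N → w < n
  <N⇒<n w<N = ≤-trans w<N (≤-trans N≤n₁ (n≤1+n n₁))

  -- Layers 0, …, N - 1 are joined in the order of the walk: an up-step by m from w joins
  -- α at w to α′ at w + m, a down-step by k joins β at w to β′ at w - k.
  data WalkUsed (j w : ℕ) : Role → Set where
    up       : w < N → w < k → w ≢ walk j → WalkUsed j w α
    down     : w < N → k ≤ w → w ≢ walk j → WalkUsed j w β
    fromDown : w < N → w < m → w ≢ m₀ → WalkUsed j w β′
    fromUp   : w < N → m ≤ w → w ≢ m₀ → WalkUsed j w α′

  Visited : ℕ → ℕ → Set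
  Visited j w = Σ ℕ λ i → i ≤ j × walk i ≡ w

  private
    walkStep : ∀ j → suc j < N → Assembled (Visited j) (WalkUsed j) →
               ∀ {r r′} → Partners r r′ → Gap (walk j) (walk (suc j)) → ¬ WalkUsed j (walk j) r →
               WalkUsed (suc j) (walk j) r → WalkUsed (suc j) (walk (suc j)) r′ →
               Assembled (Visited (suc j)) (WalkUsed (suc j))
    walkStep j sj<N A partners gap unused used used′ =
      Assembled-resp Visited-suc⁺ Visited-suc⁻ (λ _ _ u → u)
        (extend A (<N⇒<n (walk<N (suc j) sj<N)) (<N⇒<n (walk<N j (<-trans (n<1+n j) sj<N)))
                unvisited (j , ≤-refl , refl) gap partners unused (WalkUsed (suc j)) stillUsed used used′)
      where
      unvisited : ¬ Visited j (walk (suc j))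
      unvisited (i , i≤j , e) = walk-injective i (suc j) (s≤s i≤j) (≤-trans sj<N (n≤1+n N)) e
      stillUsed : ∀ v s → v ≢ walk (suc j) → WalkUsed j v s → WalkUsed (suc j) v s
      stillUsed v s v≢ (up p q _) = up p q v≢
      stillUsed v s v≢ (down p q _) = down p q v≢
      stillUsed v s v≢ (fromDown p q r) = fromDown p q r
      stillUsed v s v≢ (fromUp p q r) = fromUp p q r
      Visited-suc⁺ : ∀ v → Visited j v ⊎ v ≡ walk (suc j) → Visited (suc j) v
      Visited-suc⁺ v (inj₁ (i , i≤j , e)) = i , m≤n⇒m≤1+n i≤j , e
      Visited-suc⁺ v (inj₂ e) = suc j , ≤-refl , sym e
      Visited-suc⁻ : ∀ v → Visited (suc j) v → Visited j v ⊎ v ≡ walk (suc j)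
      Visited-suc⁻ v (i , i≤sj , e) with m≤n⇒m<n∨m≡n i≤sj
      ... | inj₁ i<sj = inj₁ (i , ≤-pred i<sj , e)
      ... | inj₂ refl = inj₂ (sym e)

    walk-first≢ : ∀ j → suc j < N → walk (suc j) ≢ m₀
    walk-first≢ j sj<N e = walk-injective 0 (suc j) (s≤s z≤n) (≤-trans sj<N (n≤1+n N)) (trans walk-first (sym e))

  walkAssembly : ∀ j → j < N → Assembled (Visited j) (WalkUsed j)
  walkAssembly zero _ =
    Assembled-resp (λ w e → 0 , z≤n , trans (sym (toℕ-fromℕ< first<n)) (sym e))
                   (λ { w (zero , _ , e) → trans (sym e) (sym (toℕ-fromℕ< first<n)) }) (λ _ _ u → u)
                   (singleLayer (fromℕ< first<n) (WalkUsed 0))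
    where
    first<n : walk 0 < n
    first<n = <N⇒<n (walk<N 0 (s≤s z≤n))
  walkAssembly (suc j) sj<N = advance (walk j <? k)
    where
    j<N : j < N
    j<N = <-trans (n<1+n j) sj<N
    moved : walk j ≢ walk (suc j)
    moved = walk-injective j (suc j) (n<1+n j) (≤-trans sj<N (n≤1+n N))
    advance : Dec (walk j < k) → Assembled (Visited (suc j)) (WalkUsed (suc j))
    advance (yes w<k) =
      walkStep j sj<N (walkAssembly j j<N) α-α′ (subst (Gap (walk j)) (sym walk-step) (Gap-+ (walk j) m-step))
               (λ { (up _ _ w≢) → w≢ refl }) (up (walk<N j j<N) w<k moved)
               (fromUp (walk<N (suc j) sj<N) (subst (m ≤_) (sym walk-step) (m≤n+m m (walk j))) (walk-first≢ j sj<N))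
      where
      walk-step : walk (suc j) ≡ walk j + m
      walk-step = walk-up j w<k
    advance (no w≮k) =
      walkStep j sj<N (walkAssembly j j<N) β-β′ (subst (Gap (walk j)) (sym walk-step) (Gap-∸ (walk j) k-step k≤w))
               (λ { (down _ _ w≢) → w≢ refl }) (down (walk<N j j<N) k≤w moved)
               (fromDown (walk<N (suc j) sj<N) (subst (_< m) (sym walk-step) below-m) (walk-first≢ j sj<N))
      where
      k≤w : k ≤ walk j
      k≤w = ≮⇒≥ w≮k
      walk-step : walk (suc j) ≡ walk j ∸ k
      walk-step = walk-down j k≤w
      below-m : walk j ∸ k < m
      below-m = m<n+o⇒m∸n<o (walk j) k
                  (≤-trans (walk<N j j<N) (≤-trans (n≤1+n N) (≤-reflexive (trans (sym m+k≡M) (+-comm m k)))))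

  -- Every further layer T < n₁ is joined by α at T - m to α′ at T.
  data StackUsed (T w : ℕ) : Role → Set where
    walked  : ∀ {r} → WalkUsed (m₀ + k₀) w r → StackUsed T w r
    support : k₀ ≤ w → w + m < T → StackUsed T w α
    stacked : N ≤ w → w < T → StackUsed T w α′

  stackAssembly : ∀ e → e + N ≤ n₁ → Assembled (_< e + N) (StackUsed (e + N))
  stackAssembly zero _ =
    Assembled-resp (λ w (i , i≤L , e) → subst (_< N) e (walk<N i (s≤s i≤L)))
                   (λ w w<N → let (j , j<N , e) = walk-surjective w w<N in j , ≤-pred j<N , e)
                   (λ _ _ → walked) (walkAssembly (m₀ + k₀) (n<1+n _))
  stackAssembly (suc e) le =
    Assembled-resp (λ { v (inj₁ v<T) → m<n⇒m<1+n v<T ; v (inj₂ refl) → n<1+n T })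
                   (λ v v<sT → m≤n⇒m<n∨m≡n (≤-pred v<sT)) (λ _ _ u → u)
                   (extend (stackAssembly e (≤-trans (n≤1+n _) le)) T<n (<-trans T∸m<T T<n)
                           (<-irrefl refl) T∸m<T (Gap-sym {T} {T ∸ m} (Gap-∸ T m-step m≤T)) α-α′ unused
                           (StackUsed (suc T)) stillUsed
                           (support k₀≤T∸m (subst (_< suc T) (sym (m∸n+n≡m m≤T)) (n<1+n T)))
                           (stacked (m≤n+m N e) (n<1+n T)))
    where
    T : ℕ
    T = e + N
    T<n : T < n
    T<n = ≤-trans le (n≤1+n n₁)
    m≤T : m ≤ T
    m≤T = ≤-trans (s≤s (m≤m+n m₀ k₀)) (m≤n+m N e)
    T∸m<T : T ∸ m < T
    T∸m<T = ∸-monoʳ-< {o = 0} (s≤s z≤n) m≤T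
    k₀≤T∸m : k₀ ≤ T ∸ m
    k₀≤T∸m = subst (_≤ T ∸ m) (m+n∸m≡n m₀ k₀) (∸-monoˡ-≤ m (m≤n+m N e))
    unused : ¬ StackUsed T (T ∸ m) α
    unused (walked (up _ below-k ≢last)) = ≢last (trans (≤-antisym (≤-pred below-k) k₀≤T∸m) (sym walk-last))
    unused (support _ lt) = <-irrefl (m∸n+n≡m m≤T) lt
    stillUsed : ∀ v s → v ≢ T → StackUsed T v s → StackUsed (suc T) v s
    stillUsed v s _ (walked u) = walked u
    stillUsed v s _ (support p lt) = support p (m<n⇒m<1+n lt)
    stillUsed v s _ (stacked p lt) = stacked p (m<n⇒m<1+n lt)

  -- The top layer n₁ is joined by β′ at n₁ - k to β at n₁.
  data FinalUsed (w : ℕ) : Role → Set where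
    stacked : ∀ {r} → StackUsed n₁ w r → FinalUsed w r
    support : w ≡ n₁ ∸ k → FinalUsed w β′
    top     : w ≡ n₁ → FinalUsed w β

  finalAssembly : Assembled (_< n) FinalUsed
  finalAssembly =
    Assembled-resp (λ { v (inj₁ v<n₁) → m<n⇒m<1+n v<n₁ ; v (inj₂ refl) → n<1+n n₁ })
                   (λ v v<n → m≤n⇒m<n∨m≡n (≤-pred v<n)) (λ _ _ u → u)
                   (extend stacks (n<1+n n₁) (≤-trans n₁∸k<n₁ (n≤1+n n₁)) (<-irrefl refl) n₁∸k<n₁
                           (Gap-sym {n₁} {n₁ ∸ k} (Gap-∸ n₁ k-step k≤n₁)) β′-β unused
                           FinalUsed (λ _ _ _ → stacked) (support refl) (top refl))
    where
    stacks : Assembled (_< n₁) (StackUsed n₁)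
    stacks = subst (λ T → Assembled (_< T) (StackUsed T)) (m∸n+n≡m N≤n₁)
                   (stackAssembly (n₁ ∸ N) (≤-reflexive (m∸n+n≡m N≤n₁)))
    k≤n₁ : k ≤ n₁
    k≤n₁ = ≤-trans (s≤s (m≤n+m k₀ m₀)) N≤n₁
    n₁∸k<n₁ : n₁ ∸ k < n₁
    n₁∸k<n₁ = ∸-monoʳ-< {o = 0} (s≤s z≤n) k≤n₁
    m₀≤n₁∸k : m₀ ≤ n₁ ∸ k
    m₀≤n₁∸k = subst (_≤ n₁ ∸ k) (m+n∸n≡m m₀ k₀) (∸-monoˡ-≤ k N≤n₁)
    unused : ¬ StackUsed n₁ (n₁ ∸ k) β′
    unused (walked (fromDown _ below-m ≢first)) = ≢first (≤-antisym (≤-pred below-m) m₀≤n₁∸k)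

  private
    βLayer : Σ ℕ λ z → (z ≡ m₀ ⊎ z ≡ k₀) × z ≢ n₁ ∸ k
    βLayer with n₁ ∸ k ≟ k₀
    ... | yes e = m₀ , inj₁ refl , λ e′ → <⇒≢ m<k (trans e′ e)
    ... | no ne = k₀ , inj₂ refl , λ e → ne (sym e)

    zβ : ℕ
    zβ = proj₁ βLayer

    zβ<k : zβ < k
    zβ<k with βLayer
    ... | _ , inj₁ refl , _ = ≤-trans (n≤1+n _) (s≤s m<k)
    ... | _ , inj₂ refl , _ = n<1+n k₀

    zβ<n₁ : zβ < n₁
    zβ<n₁ = ≤-trans zβ<k (≤-trans (s≤s (m≤n+m k₀ m₀)) N≤n₁)

    free-α : ∀ {w} → w ≡ n₁ → ¬ FinalUsed w α
    free-α refl (stacked (walked (up w<N _ _))) = <⇒≱ w<N N≤n₁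
    free-α refl (stacked (support _ lt)) = <-irrefl refl (≤-<-trans (m≤m+n n₁ m) lt)

    free-α′ : ∀ {w} → w ≡ n₁ → ¬ FinalUsed w α′
    free-α′ refl (stacked (walked (fromUp w<N _ _))) = <⇒≱ w<N N≤n₁
    free-α′ refl (stacked (stacked _ lt)) = <-irrefl refl lt

    free-β : ∀ {w} → w ≡ zβ → ¬ FinalUsed w β
    free-β refl (stacked (walked (down _ k≤w _))) = <⇒≱ zβ<k k≤w
    free-β refl (top e) = <⇒≢ zβ<n₁ e

    free-β′ : ∀ {w} → w ≡ zβ → ¬ FinalUsed w β′
    free-β′ refl (stacked (walked (fromDown _ w<m ≢first))) with βLayer
    ... | _ , inj₁ refl , _ = ≢first refl
    ... | _ , inj₂ refl , _ = <⇒≱ w<m m<k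
    free-β′ refl (support e) = proj₂ (proj₂ βLayer) e

  extended : LinkedCycle (suc d)
  extended = relink finalAssembly (fromℕ n₁) (fromℕ< (≤-trans zβ<n₁ (n≤1+n n₁)))
                    (free-α (toℕ-fromℕ n₁)) (free-α′ (toℕ-fromℕ n₁))
                    (free-β (toℕ-fromℕ< _)) (free-β′ (toℕ-fromℕ< _))

linkedCycles : ∀ {a b n₁} → Steps a b n₁ → Knight.LinkedCycle a b (suc n₁) 2 →
               ∀ e → Knight.LinkedCycle a b (suc n₁) (e + 2)
linkedCycles S G zero = G
linkedCycles S G (suc e) = Extension.extended _ _ _ S (linkedCycles S G e)

module Planar (a b n₂ : ℕ) (1≤a : 1 ≤ a) (1≤b : 1 ≤ b) (a+b≤n : a + b ≤ suc (suc n₂))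
              (T : KnightTour a b (suc (suc n₂)) 2) (linked : Linked T) where

  open import Data.Nat
  open import Data.Nat.Properties
  open import Data.Nat.DivMod using (_%_; %-remove-+ʳ)
  open import Data.Nat.Divisibility using (_∣_; 0∣⇒≡0)
  open import Data.Nat.Coprimality using (Coprime)
  open import Data.Fin using (Fin; toℕ; fromℕ) renaming (zero to fzero; suc to fsuc)
  open import Data.Fin.Properties using (toℕ-injective; toℕ-fromℕ; toℕ<n)
  open import Data.Vec using (_∷_; []; lookup)
  open import Data.List using (List; _∷_; tabulate)
  open import Data.List.Membership.Propositional using (_∈_)
  open import Data.List.Membership.Propositional.Properties using (∈-tabulate⁺)
  open import Data.Product using (Σ; _×_; _,_; proj₁; proj₂)
  open import Data.Sum using (_⊎_; inj₁; inj₂; swap)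
  import Data.Sum
  open import Data.Empty using (⊥-elim)
  open import Function using (_∘_)
  open import Relation.Nullary using (¬_)
  open import Relation.Binary.PropositionalEquality
  open CyclicList

  n₁ n : ℕ
  n₁ = suc n₂
  n = suc n₁

  open Knight a b n
  open HamiltonianCycle T
  open Enumeration (Adj 2) Adj-sym
  open Cycle (Adj 2) Adj-sym using (module IsCycle)

  Pt : Set
  Pt = Point n 2

  tour : List Pt
  tour = tabulate cyc

  tour-isCycle : KnightCycle 2 tour
  tour-isCycle = IsCycle-tabulate len-1 cyc len≥3 injCyc (λ i j s → adj (adjCyc i j s))

  tour-spanning : ∀ v → v ∈ tour
  tour-spanning v with surjCyc v
  ... | i , cyc≡ = subst (_∈ tour) (cyc≡ refl) (∈-tabulate⁺ {f = cyc} i)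

  coords-injective : ∀ {u v : Pt} → coords u ≡ coords v → u ≡ v
  coords-injective {_ ∷ _ ∷ []} {_ ∷ _ ∷ []} e =
    cong₂ (λ p q → p ∷ q ∷ []) (toℕ-injective (cong proj₁ e)) (toℕ-injective (cong proj₂ e))

  EdgeBetween : ℕ × ℕ → ℕ × ℕ → Set
  EdgeBetween P Q = Σ Pt λ u → Σ Pt λ v → coords u ≡ P × coords v ≡ Q × Edge tour u v

  edgeAt : ∀ {P Q} → ContainsEdge T P Q → EdgeBetween P Q
  edgeAt (i , j , s , inj₁ (e₁ , e₂)) =
    cyc i , cyc j , e₁ , e₂ , inj₁ (Succ-tabulate len-1 cyc (≤-trans (s≤s z≤n) len≥3) s)
  edgeAt (i , j , s , inj₂ (e₁ , e₂)) =
    cyc j , cyc i , e₂ , e₁ , inj₂ (Succ-tabulate len-1 cyc (≤-trans (s≤s z≤n) len≥3) s)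

  origin corner : Pt
  origin = fzero ∷ fzero ∷ []
  corner = fromℕ n₁ ∷ fzero ∷ []

  origin-moves : ∀ w → Adj 2 origin w → coords w ≡ (a , b) ⊎ coords w ≡ (b , a)
  origin-moves (_ ∷ _ ∷ []) (adj (fzero , fzero , i≢j , _)) = ⊥-elim (i≢j refl)
  origin-moves (_ ∷ _ ∷ []) (adj (fzero , fsuc fzero , _ , ea , eb , _)) = inj₁ (cong₂ _,_ ea eb)
  origin-moves (_ ∷ _ ∷ []) (adj (fsuc fzero , fzero , _ , ea , eb , _)) = inj₂ (cong₂ _,_ eb ea)
  origin-moves (_ ∷ _ ∷ []) (adj (fsuc fzero , fsuc fzero , i≢j , _)) = ⊥-elim (i≢j refl)

  private
    below-top : ∀ (x : Fin n) {c} → ∣ n₁ - toℕ x ∣ ≡ c → toℕ x ≡ n₁ ∸ c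
    below-top x {c} e = trans (sym (m∸[m∸n]≡n x≤n₁)) (cong (n₁ ∸_) (trans (sym (m≤n⇒∣n-m∣≡n∸m x≤n₁)) e))
      where
      x≤n₁ : toℕ x ≤ n₁
      x≤n₁ = ≤-pred (toℕ<n x)

  corner-moves : ∀ w → Adj 2 corner w → coords w ≡ (n₁ ∸ a , b) ⊎ coords w ≡ (n₁ ∸ b , a)
  corner-moves (_ ∷ _ ∷ []) (adj (fzero , fzero , i≢j , _)) = ⊥-elim (i≢j refl)
  corner-moves (w₀ ∷ _ ∷ []) (adj (fzero , fsuc fzero , _ , ea , eb , _)) =
    inj₁ (cong₂ _,_ (below-top w₀ (subst (λ t → ∣ t - toℕ w₀ ∣ ≡ a) (toℕ-fromℕ n₁) ea)) eb)
  corner-moves (w₀ ∷ _ ∷ []) (adj (fsuc fzero , fzero , _ , ea , eb , _)) =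
    inj₂ (cong₂ _,_ (below-top w₀ (subst (λ t → ∣ t - toℕ w₀ ∣ ≡ b) (toℕ-fromℕ n₁) eb)) ea)
  corner-moves (_ ∷ _ ∷ []) (adj (fsuc fzero , fsuc fzero , i≢j , _)) = ⊥-elim (i≢j refl)

  private
    pick : ∀ {X Y} (p s : Pt) → p ≢ s → coords p ≡ X ⊎ coords p ≡ Y → coords s ≡ X ⊎ coords s ≡ Y →
           coords p ≡ X ⊎ coords s ≡ X
    pick p s _ (inj₁ e) _ = inj₁ e
    pick p s _ (inj₂ _) (inj₁ e) = inj₂ e
    pick p s p≢s (inj₂ e₁) (inj₂ e₂) = ⊥-elim (p≢s (coords-injective (trans e₁ (sym e₂))))

    neighbours : ∀ v → Neighbours.Neighbours tour v
    neighbours v = Neighbours.neighbours tour (IsCycle.unique tour-isCycle) (IsCycle.length≥3 tour-isCycle)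
                                         (tour-spanning v)

  -- A corner square has only two knight moves, so the tour uses both.
  a≢b : a ≢ b
  a≢b refl with neighbours origin
  ... | p , s , p→o , o→s , p≢s = p≢s (coords-injective (trans
          (Data.Sum.reduce (origin-moves p (Adj-sym (IsCycle.adjacent tour-isCycle p→o))))
          (sym (Data.Sum.reduce (origin-moves s (IsCycle.adjacent tour-isCycle o→s))))))

  originEdge : Σ Pt λ w → coords w ≡ (a , b) × Edge tour origin w
  originEdge with neighbours origin
  ... | p , s , p→o , o→s , p≢s
    with pick p s p≢s (origin-moves p (Adj-sym (IsCycle.adjacent tour-isCycle p→o)))
                      (origin-moves s (IsCycle.adjacent tour-isCycle o→s))
  ... | inj₁ e = p , e , inj₂ p→o
  ... | inj₂ e = s , e , inj₁ o→s

  cornerEdge : Σ Pt λ w → coords w ≡ (n₁ ∸ b , a) × Edge tour w corner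
  cornerEdge with neighbours corner
  ... | p , s , p→c , c→s , p≢s
    with pick p s p≢s (swap (corner-moves p (Adj-sym (IsCycle.adjacent tour-isCycle p→c))))
                      (swap (corner-moves s (IsCycle.adjacent tour-isCycle c→s)))
  ... | inj₁ e = p , e , inj₁ p→c
  ... | inj₂ e = s , e , inj₂ c→s

  private
    linkα : EdgeBetween (0 , b) (a , 0)
    linkα = edgeAt (proj₁ linked)
    linkβ : EdgeBetween (n₁ , a) (n ∸ b ∸ 1 , 0)
    linkβ = edgeAt (proj₂ linked)

    n∸b∸1≡n₁∸b : n ∸ b ∸ 1 ≡ n₁ ∸ b
    n∸b∸1≡n₁∸b = trans (∸-+-assoc n b 1) (cong (n ∸_) (+-comm b 1))

  ex ey : Role → Pt
  ex α = proj₁ linkα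
  ex α′ = origin
  ex β = proj₁ linkβ
  ex β′ = proj₁ cornerEdge
  ey α = proj₁ (proj₂ linkα)
  ey α′ = proj₁ originEdge
  ey β = proj₁ (proj₂ linkβ)
  ey β′ = corner

  coords-ex : Role → ℕ × ℕ
  coords-ex α = 0 , b
  coords-ex α′ = 0 , 0
  coords-ex β = n₁ , a
  coords-ex β′ = n₁ ∸ b , a

  coords-ey : Role → ℕ × ℕ
  coords-ey α = a , 0
  coords-ey α′ = a , b
  coords-ey β = n₁ ∸ b , 0
  coords-ey β′ = n₁ , 0

  ex-coords : ∀ r → coords (ex r) ≡ coords-ex r
  ex-coords α = proj₁ (proj₂ (proj₂ linkα))
  ex-coords α′ = refl
  ex-coords β = proj₁ (proj₂ (proj₂ linkβ))
  ex-coords β′ = proj₁ (proj₂ cornerEdge)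

  ey-coords : ∀ r → coords (ey r) ≡ coords-ey r
  ey-coords α = proj₁ (proj₂ (proj₂ (proj₂ linkα)))
  ey-coords α′ = proj₁ (proj₂ originEdge)
  ey-coords β = trans (proj₁ (proj₂ (proj₂ (proj₂ linkβ)))) (cong (_, 0) n∸b∸1≡n₁∸b)
  ey-coords β′ = cong (_, 0) (toℕ-fromℕ n₁)

  edge : ∀ r → Edge tour (ex r) (ey r)
  edge α = proj₂ (proj₂ (proj₂ (proj₂ linkα)))
  edge α′ = proj₂ (proj₂ originEdge)
  edge β = proj₂ (proj₂ (proj₂ (proj₂ linkβ)))
  edge β′ = proj₂ (proj₂ cornerEdge)

  private
    differ-x : ∀ {c x₁ x₂ y} (u v : Pt) → coords u ≡ (x₁ , y) → coords v ≡ (x₂ , y) → ∣ x₁ - x₂ ∣ ≡ c →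
               Differ 2 c u v
    differ-x (x ∷ _ ∷ []) (_ ∷ _ ∷ []) refl cv e =
      fzero , subst (λ t → ∣ toℕ x - t ∣ ≡ _) (sym (cong proj₁ cv)) e ,
      λ { fzero k≢0 → ⊥-elim (k≢0 refl) ; (fsuc fzero) _ → toℕ-injective (sym (cong proj₂ cv)) }

    differ-y : ∀ {c x y₁ y₂} (u v : Pt) → coords u ≡ (x , y₁) → coords v ≡ (x , y₂) → ∣ y₁ - y₂ ∣ ≡ c →
               Differ 2 c u v
    differ-y (_ ∷ y ∷ []) (_ ∷ _ ∷ []) refl cv e =
      fsuc fzero , subst (λ t → ∣ toℕ y - t ∣ ≡ _) (sym (cong proj₂ cv)) e ,
      λ { fzero _ → toℕ-injective (sym (cong proj₁ cv)) ; (fsuc fzero) k≢1 → ⊥-elim (k≢1 refl) }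

    b≤n₁ : b ≤ n₁
    b≤n₁ = ≤-pred (≤-trans (+-monoˡ-≤ b 1≤a) a+b≤n)

    crossableα : Crossable (ex α) (ey α) (ex α′) (ey α′)
    crossableα = differ-y (ex α) (ex α′) (ex-coords α) refl (∣-∣-comm b 0)
               , differ-y (ey α) (ey α′) (ey-coords α) (ey-coords α′) refl
               , differ-x (ex α) (ey α′) (ex-coords α) (ey-coords α′) refl
               , differ-x (ey α) (ex α′) (ey-coords α) refl (∣-∣-comm a 0)

    crossableβ : Crossable (ex β) (ey β) (ex β′) (ey β′)
    crossableβ = differ-x (ex β) (ex β′) (ex-coords β) (ex-coords β′) (∣m-m∸n∣≡n n₁ b≤n₁)
               , differ-x (ey β) (ey β′) (ey-coords β) (ey-coords β′) (trans (∣-∣-comm (n₁ ∸ b) n₁) (∣m-m∸n∣≡n n₁ b≤n₁))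
               , differ-y (ex β) (ey β′) (ex-coords β) (ey-coords β′) (∣-∣-comm a 0)
               , differ-y (ey β) (ex β′) (ey-coords β) (ex-coords β′) refl

    apart : ∀ {p q : Pt} {P Q} (f : ℕ × ℕ → ℕ) → coords p ≡ P → coords q ≡ Q → f P ≢ f Q → p ≢ q
    apart f refl refl fP≢fQ refl = fP≢fQ refl

    edges-apart : ∀ {p q u v : Pt} → p ≢ u ⊎ q ≢ v → p ≢ v ⊎ q ≢ u → ¬ SameEdge p q u v
    edges-apart (inj₁ p≢u) _ (inj₁ (p≡u , _)) = p≢u p≡u
    edges-apart (inj₂ q≢v) _ (inj₁ (_ , q≡v)) = q≢v q≡v
    edges-apart _ (inj₁ p≢v) (inj₂ (p≡v , _)) = p≢v p≡v
    edges-apart _ (inj₂ q≢u) (inj₂ (_ , q≡u)) = q≢u q≡u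

    a≢0 : a ≢ 0
    a≢0 e = <⇒≢ 1≤a (sym e)
    b≢0 : b ≢ 0
    b≢0 e = <⇒≢ 1≤b (sym e)

    distinct : ∀ r s → r ≢ s → ¬ SameEdge (ex r) (ey r) (ex s) (ey s)
    distinct α α′ _ = edges-apart (inj₁ (apart proj₂ (ex-coords α) (ex-coords α′) b≢0))
                                  (inj₁ (apart proj₁ (ex-coords α) (ey-coords α′) (a≢0 ∘ sym)))
    distinct α β _ = edges-apart (inj₁ (apart proj₁ (ex-coords α) (ex-coords β) (λ ())))
                                 (inj₁ (apart proj₂ (ex-coords α) (ey-coords β) b≢0))
    distinct α β′ _ = edges-apart (inj₁ (apart proj₂ (ex-coords α) (ex-coords β′) (a≢b ∘ sym)))
                                  (inj₁ (apart proj₂ (ex-coords α) (ey-coords β′) b≢0))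
    distinct α′ β _ = edges-apart (inj₁ (apart proj₂ (ex-coords α′) (ex-coords β) (a≢0 ∘ sym)))
                                  (inj₂ (apart proj₂ (ey-coords α′) (ex-coords β) (a≢b ∘ sym)))
    distinct α′ β′ _ = edges-apart (inj₁ (apart proj₂ (ex-coords α′) (ex-coords β′) (a≢0 ∘ sym)))
                                   (inj₁ (apart proj₁ (ex-coords α′) (ey-coords β′) (λ ())))
    distinct β β′ _ = edges-apart (inj₁ (apart proj₁ (ex-coords β) (ex-coords β′) n₁≢n₁∸b))
                                  (inj₁ (apart proj₂ (ex-coords β) (ey-coords β′) a≢0))
      where n₁≢n₁∸b : n₁ ≢ n₁ ∸ b
            n₁≢n₁∸b e = <⇒≢ (∸-monoʳ-< {o = 0} 1≤b b≤n₁) (sym e)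
    distinct α′ α r≢s = distinct α α′ (r≢s ∘ sym) ∘ SameEdge-sym
    distinct β α r≢s = distinct α β (r≢s ∘ sym) ∘ SameEdge-sym
    distinct β′ α r≢s = distinct α β′ (r≢s ∘ sym) ∘ SameEdge-sym
    distinct β α′ r≢s = distinct α′ β (r≢s ∘ sym) ∘ SameEdge-sym
    distinct β′ α′ r≢s = distinct α′ β′ (r≢s ∘ sym) ∘ SameEdge-sym
    distinct β′ β r≢s = distinct β β′ (r≢s ∘ sym) ∘ SameEdge-sym
    distinct α α r≢s = ⊥-elim (r≢s refl)
    distinct α′ α′ r≢s = ⊥-elim (r≢s refl)
    distinct β β r≢s = ⊥-elim (r≢s refl)
    distinct β′ β′ r≢s = ⊥-elim (r≢s refl)

  linkedCycle : LinkedCycle 2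
  linkedCycle = record
    { cycle = tour ; isCycle = tour-isCycle ; spanning = tour-spanning ; ex = ex ; ey = ey ; edge = edge
    ; distinct = distinct ; crossableα = crossableα ; crossableβ = crossableβ }

  private
    column : Pt → ℕ
    column v = toℕ (lookup v fzero)

    column-step : ∀ {g} → g ∣ a → g ∣ b → ∀ {u v} → Adj 2 u v → g ∣ ∣ column u - column v ∣
    column-step g∣a g∣b (adj (fzero , _ , _ , ea , _)) = subst (_ ∣_) (sym ea) g∣a
    column-step g∣a g∣b (adj (fsuc fzero , fzero , _ , _ , eb , _)) = subst (_ ∣_) (sym eb) g∣b
    column-step g∣a g∣b (adj (fsuc fzero , fsuc fzero , i≢j , _)) = ⊥-elim (i≢j refl)

    ∣distance⇒%≡ : ∀ g .{{_ : NonZero g}} u v → g ∣ ∣ u - v ∣ → u % g ≡ v % g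
    ∣distance⇒%≡ g u v g∣ with ≤-total u v
    ... | inj₁ u≤v = sym (trans (cong (_% g) (sym (m+[n∸m]≡n u≤v)))
                                (%-remove-+ʳ u (subst (g ∣_) (m≤n⇒∣m-n∣≡n∸m u≤v) g∣)))
    ... | inj₂ v≤u = trans (cong (_% g) (sym (m+[n∸m]≡n v≤u)))
                           (%-remove-+ʳ v (subst (g ∣_) (m≤n⇒∣n-m∣≡n∸m v≤u) g∣))

    column-residue : ∀ g .{{_ : NonZero g}} → g ∣ a → g ∣ b → ∀ v → column v % g ≡ column (cyc fzero) % g
    column-residue g g∣a g∣b v = Consecutive-constant (λ u → column u % g) _
      (λ {u} {w} c → ∣distance⇒%≡ g (column u) (column w)
                        (column-step g∣a g∣b (IsCycle.adjacent tour-isCycle (inj₁ c))))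
      (tour-spanning v)

  -- The column modulo any common divisor of a and b is invariant along the tour,
  -- which passes through both (0, 0) and (1, 0).
  coprime : Coprime a b
  coprime {0} (0∣a , _) = ⊥-elim (a≢0 (0∣⇒≡0 0∣a))
  coprime {1} _ = refl
  coprime {suc (suc g)} (g∣a , g∣b)
    with () ← trans (column-residue _ g∣a g∣b origin) (sym (column-residue _ g∣a g∣b (fsuc fzero ∷ fzero ∷ [])))

lemma12 : (a b n : ℕ) → 1 ≤ a → 1 ≤ b → a + b ≤ n →
          Σ (KnightTour a b n 2) Linked →
          (d : ℕ) → 2 ≤ d → KnightTour a b n d
lemma12 (suc a₀) (suc b₀) n@(suc (suc n₂)) 1≤a 1≤b a+b≤n (T , linked) d 2≤d =
  subst (KnightTour (suc a₀) (suc b₀) n) (m∸n+n≡m 2≤d)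
        (Knight.LinkedCycle⇒KnightTour _ _ _
          (linkedCycles (steps a₀ b₀ (suc n₂) a≢b coprime a+b≤n) linkedCycle (d ∸ 2)))
  where open Planar (suc a₀) (suc b₀) n₂ 1≤a 1≤b a+b≤n T linked using (linkedCycle; a≢b; coprime)
lemma12 (suc a₀) (suc b₀) 1 _ _ (s≤s a₀+b≤0) with () ← subst (_≤ 0) (+-suc a₀ b₀) a₀+b≤0
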